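{- (a) For every even integer $N \geq 2$, $\det C_N = 0$. (b) If $N = 2^k N_0$ with $k \geq 1$ and $N_0$ odd, then $P_N(x) = x^{N - N_0} P_{N_0}(x)$.
   Context: The Collatz function is $T(n) = n/2$ if $n$ is even and $T(n) = (3n+1)/2$ if $n$ is odd, for nonnegative integers $n$. For an integer $N \geq 1$ the modular Collatz graph $G_N$ has vertex set $\mathbb{Z}_N = \{0,1,\ldots,N-1\}$ and adjacency matrix $C_N = (c_{i,j})_{0 \le i,j \le N-1}$ with $c_{i,j} = \#\{\nu \in \{i, i+N\} : T(\nu) \equiv j \pmod N\}$; in particular $C_1 = (2)$. $P_N(x) = \det(x I_N - C_N)$ denotes the characteristic polynomial of $C_N$. -}

module Defs where

open import Data.Nat as ℕ using (ℕ; zero; suc)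
open import Data.Nat.DivMod using (_/_; _%_)
open import Data.Fin using (Fin; toℕ; punchIn) renaming (zero to fzero; suc to fsuc)
open import Data.Integer as ℤ using (ℤ; +_)
open import Data.List using (List; []; _∷_; map; replicate; _++_)
open import Relation.Nullary using (yes; no)
open import Relation.Binary.PropositionalEquality using (_≡_)

T : ℕ → ℕ
T n with n % 2
... | zero  = n / 2
... | suc _ = (3 ℕ.* n ℕ.+ 1) / 2

-- The adjacency matrix C_N of the modular Collatz graph G_N
-- c_{i,j} = #{ν ∈ {i, i+N} : T(ν) ≡ j (mod N)}

hits : (m : ℕ) → ℕ → Fin (suc m) → ℕ
hits m ν j with T ν % suc m ℕ.≟ toℕ j
... | yes _ = 1
... | no  _ = 0

C : (N : ℕ) → Fin N → Fin N → ℕ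
C (suc m) i j = hits m (toℕ i) j ℕ.+ hits m (toℕ i ℕ.+ suc m) j

module Det {A : Set} (1# : A) (_+_ _*_ : A → A → A) (-_ : A → A) where

  signed : ℕ → A → A
  signed zero    a = a
  signed (suc k) a = - (signed k a)

  sumFin : (n : ℕ) → (Fin (suc n) → A) → A
  sumFin zero    f = f fzero
  sumFin (suc n) f = f fzero + sumFin n (λ j → f (fsuc j))

  det : (n : ℕ) → (Fin n → Fin n → A) → A
  det zero    M = 1#
  det (suc n) M =
    sumFin n (λ j → signed (toℕ j)
      (M fzero j * det n (λ r c → M (fsuc r) (punchIn j c))))

-- Polynomials over ℤ as coefficient lists (constant term first)

Poly : Set
Poly = List ℤ

_+ₚ_ : Poly → Poly → Poly
[]      +ₚ q       = q
(a ∷ p) +ₚ []      = a ∷ p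
(a ∷ p) +ₚ (b ∷ q) = (a ℤ.+ b) ∷ (p +ₚ q)

_·ₚ_ : ℤ → Poly → Poly
a ·ₚ p = map (a ℤ.*_) p

_*ₚ_ : Poly → Poly → Poly
[]      *ₚ q = []
(a ∷ p) *ₚ q = (a ·ₚ q) +ₚ (+ 0 ∷ (p *ₚ q))

-ₚ_ : Poly → Poly
-ₚ p = map (λ a → ℤ.- a) p

constₚ : ℤ → Poly
constₚ a = a ∷ []

Xpow : ℕ → Poly
Xpow k = replicate k (+ 0) ++ (+ 1 ∷ [])

coeff : Poly → ℕ → ℤ
coeff []      _       = + 0
coeff (a ∷ p) zero    = a
coeff (a ∷ p) (suc i) = coeff p i

_≈ₚ_ : Poly → Poly → Set
p ≈ₚ q = ∀ i → coeff p i ≡ coeff q i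

detℤ : (n : ℕ) → (Fin n → Fin n → ℤ) → ℤ
detℤ = Det.det (+ 1) ℤ._+_ ℤ._*_ (λ a → ℤ.- a)

detₚ : (n : ℕ) → (Fin n → Fin n → Poly) → Poly
detₚ = Det.det (constₚ (+ 1)) _+ₚ_ _*ₚ_ -ₚ_

δ : {n : ℕ} → Fin n → Fin n → Poly
δ i j with toℕ i ℕ.≟ toℕ j
... | yes _ = Xpow 1
... | no  _ = []

P : ℕ → Poly
P N = detₚ N (λ i j → δ i j +ₚ (-ₚ constₚ (+ C N i j)))

-- Let N = 2m. Since T(ν + N) ≡ T ν + m (mod N), the numbers i and i + N that define row i of
-- C_N are sent by T to the residues r and m + r mod N, where r = T i mod m. Hence column j + m
-- of C_N equals column j, which gives (a), and rows i and i + m of C_N add up, on either half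
-- of the columns, to row i of C_m. Adding the bottom half of the rows of xI − C_N to the top
-- half and subtracting the left half of the columns from the right half makes the matrix
-- block lower triangular with diagonal blocks xI − C_m and xI, so P_{2m} = x^m P_m, and (b)
-- follows by induction on k. The determinant is the Laplace expansion along the first row,
-- so its invariance under these row and column operations is derived from multilinearity and
-- the vanishing on two equal adjacent rows or columns.
module Submission where

open import Algebra using (CommutativeRing; Semiring)
open import Data.Empty using (⊥-elim)
open import Data.Fin using (Fin; toℕ; fromℕ<; punchIn; punchOut; _≟_; _↑ˡ_; _↑ʳ_)
  renaming (zero to fzero; suc to fsuc)
open import Data.Fin.Properties
  using (suc-injective; toℕ-injective; toℕ<n; toℕ-fromℕ<; toℕ-↑ˡ; toℕ-↑ʳ;
         punchInᵢ≢i; punchIn-injective; punchIn-punchOut)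
import Data.Integer as ℤ
import Data.Integer.Properties as ℤ
open import Data.List using ([]; _∷_)
open import Data.Maybe using (Maybe; just; nothing; maybe′)
open import Data.Maybe.Properties using (just-injective)
import Data.Nat as ℕ
open ℕ using (ℕ; zero; suc)
import Data.Nat.Properties as ℕ
open import Data.Product using (_×_; _,_; proj₁; proj₂)
open import Data.Sum using (_⊎_; inj₁; inj₂)
open import Data.Vec.Functional using (updateAt; _++_)
open import Data.Vec.Functional.Properties using (updateAt-updates; updateAt-minimal; lookup-++ˡ; lookup-++ʳ)
open import Function using (_∘_)
open import Level using (0ℓ)
open import Relation.Binary using (Setoid; tri<; tri≈; tri>)
open import Relation.Binary.PropositionalEquality as ≡ using (_≡_; _≢_)
open import Relation.Nullary using (yes; no)

open import Defs

+-suc-cong : ∀ a {b} c {d} → a ℕ.+ b ≡ c ℕ.+ d → suc a ℕ.+ suc b ≡ suc c ℕ.+ suc d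
+-suc-cong a {b} c {d} eq =
  ≡.cong suc (≡.trans (ℕ.+-suc a b) (≡.trans (≡.cong suc eq) (≡.sym (ℕ.+-suc c d))))

punchIn-pair-swap : ∀ {n} (j : Fin (suc (suc n))) (k k′ : Fin (suc n)) →
  punchIn (punchIn j k) k′ ≡ j → ∀ c → punchIn j (punchIn k c) ≡ punchIn (punchIn j k) (punchIn k′ c)
punchIn-pair-swap fzero    k        fzero     eq c = ≡.refl
punchIn-pair-swap (fsuc j) fzero    k′        ≡.refl c = ≡.refl
punchIn-pair-swap (fsuc j) (fsuc k) (fsuc k′) eq fzero = ≡.refl
punchIn-pair-swap (fsuc j) (fsuc k) (fsuc k′) eq (fsuc c) =
  ≡.cong fsuc (punchIn-pair-swap j k k′ (suc-injective eq) c)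

punchIn-pair-parity : ∀ {n} (j : Fin (suc (suc n))) (k k′ : Fin (suc n)) →
  punchIn (punchIn j k) k′ ≡ j →
  toℕ j ℕ.+ toℕ k ≡ suc (toℕ (punchIn j k) ℕ.+ toℕ k′) ⊎
  suc (toℕ j ℕ.+ toℕ k) ≡ toℕ (punchIn j k) ℕ.+ toℕ k′
punchIn-pair-parity fzero    k        fzero     eq = inj₂ (≡.cong suc (≡.sym (ℕ.+-identityʳ _)))
punchIn-pair-parity (fsuc j) fzero    k′        ≡.refl = inj₁ (≡.cong suc (ℕ.+-identityʳ _))
punchIn-pair-parity {suc n} (fsuc j) (fsuc k) (fsuc k′) eq
  with punchIn-pair-parity j k k′ (suc-injective eq)
... | inj₁ eq′ = inj₁ (+-suc-cong (toℕ j) (suc (toℕ (punchIn j k))) eq′)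
... | inj₂ eq′ = inj₂ (+-suc-cong (suc (toℕ j)) (toℕ (punchIn j k)) eq′)

punchIn-adjacent : ∀ {n} (u v : Fin (suc n)) → toℕ v ≡ suc (toℕ u) → ∀ c →
  punchIn u c ≡ punchIn v c ⊎ (punchIn u c ≡ v × punchIn v c ≡ u)
punchIn-adjacent fzero (fsuc fzero) _ fzero = inj₂ (≡.refl , ≡.refl)
punchIn-adjacent {suc n} fzero (fsuc fzero) _ (fsuc c) = inj₁ ≡.refl
punchIn-adjacent {suc n} (fsuc u) (fsuc v) _ fzero = inj₁ ≡.refl
punchIn-adjacent {suc n} (fsuc u) (fsuc v) v≡1+u (fsuc c)
  with punchIn-adjacent u v (ℕ.suc-injective v≡1+u) c
... | inj₁ eq         = inj₁ (≡.cong fsuc eq)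
... | inj₂ (eq , eq′) = inj₂ (≡.cong fsuc eq , ≡.cong fsuc eq′)

punchOut-adjacent : ∀ {n} {j u v : Fin (suc n)} (j≢u : j ≢ u) (j≢v : j ≢ v) →
  toℕ v ≡ suc (toℕ u) → toℕ (punchOut j≢v) ≡ suc (toℕ (punchOut j≢u))
punchOut-adjacent {j = fzero} {fzero} j≢u j≢v _ = ⊥-elim (j≢u ≡.refl)
punchOut-adjacent {j = fzero} {fsuc u} {fsuc v} j≢u j≢v v≡1+u = ℕ.suc-injective v≡1+u
punchOut-adjacent {suc n} {fsuc fzero} {fzero} {fsuc fzero} j≢u j≢v _ = ⊥-elim (j≢v ≡.refl)
punchOut-adjacent {suc (suc n)} {fsuc (fsuc j)} {fzero} {fsuc fzero} j≢u j≢v _ = ≡.refl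
punchOut-adjacent {suc n} {fsuc j} {fsuc u} {fsuc v} j≢u j≢v v≡1+u =
  ≡.cong suc (punchOut-adjacent (j≢u ∘ ≡.cong fsuc) (j≢v ∘ ≡.cong fsuc) (ℕ.suc-injective v≡1+u))

punchIn-↑ˡ-↑ʳ : ∀ {m} n (a : Fin (suc m)) (c : Fin n) → punchIn (a ↑ˡ n) (m ↑ʳ c) ≡ fsuc (m ↑ʳ c)
punchIn-↑ˡ-↑ʳ n fzero c = ≡.refl
punchIn-↑ˡ-↑ʳ {suc m} n (fsuc a) c = ≡.cong fsuc (punchIn-↑ˡ-↑ʳ n a c)

punchIn-↑ˡ-↑ˡ : ∀ {m} n (a : Fin (suc m)) (c : Fin m) → punchIn (a ↑ˡ n) (c ↑ˡ n) ≡ punchIn a c ↑ˡ n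
punchIn-↑ˡ-↑ˡ n fzero c = ≡.refl
punchIn-↑ˡ-↑ˡ n (fsuc a) fzero = ≡.refl
punchIn-↑ˡ-↑ˡ n (fsuc a) (fsuc c) = ≡.cong fsuc (punchIn-↑ˡ-↑ˡ n a c)

data BlockIndex (m n : ℕ) : Fin (m ℕ.+ n) → Set where
  top    : (a : Fin m) → BlockIndex m n (a ↑ˡ n)
  bottom : (b : Fin n) → BlockIndex m n (m ↑ʳ b)

blockIndex : ∀ m {n} (i : Fin (m ℕ.+ n)) → BlockIndex m n i
blockIndex zero     i        = bottom i
blockIndex (suc m)  fzero    = top fzero
blockIndex (suc m)  (fsuc i) with blockIndex m i
... | top a    = top (fsuc a)
... | bottom b = bottom b

PartnersFixed : ∀ {n} → (Fin n → Maybe (Fin n)) → Set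
PartnersFixed π = ∀ i j → π i ≡ just j → π j ≡ nothing

partnerBelow : ∀ m → Fin (m ℕ.+ m) → Maybe (Fin (m ℕ.+ m))
partnerBelow m = (λ a → just (m ↑ʳ a)) ++ (λ _ → nothing)

partnerLeft : ∀ m → Fin (m ℕ.+ m) → Maybe (Fin (m ℕ.+ m))
partnerLeft m = (λ _ → nothing) ++ (λ b → just (b ↑ˡ m))

module _ {m : ℕ} where

  partnerBelow-top : ∀ a → partnerBelow m (a ↑ˡ m) ≡ just (m ↑ʳ a)
  partnerBelow-top = lookup-++ˡ {m = m} {n = m} _ _

  partnerBelow-bottom : ∀ b → partnerBelow m (m ↑ʳ b) ≡ nothing
  partnerBelow-bottom = lookup-++ʳ {m = m} {n = m} _ _

  partnerLeft-left : ∀ a → partnerLeft m (a ↑ˡ m) ≡ nothing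
  partnerLeft-left = lookup-++ˡ {m = m} {n = m} _ _

  partnerLeft-right : ∀ b → partnerLeft m (m ↑ʳ b) ≡ just (b ↑ˡ m)
  partnerLeft-right = lookup-++ʳ {m = m} {n = m} _ _

  partnerBelow-fixed : PartnersFixed (partnerBelow m)
  partnerBelow-fixed i j below-i with blockIndex m i
  ... | top a with ≡.refl ← just-injective (≡.trans (≡.sym (partnerBelow-top a)) below-i) = partnerBelow-bottom a
  ... | bottom b with () ← ≡.trans (≡.sym (partnerBelow-bottom b)) below-i

  partnerLeft-fixed : PartnersFixed (partnerLeft m)
  partnerLeft-fixed i j left-i with blockIndex m i
  ... | top a with () ← ≡.trans (≡.sym (partnerLeft-left a)) left-i
  ... | bottom b with ≡.refl ← just-injective (≡.trans (≡.sym (partnerLeft-right b)) left-i) = partnerLeft-left b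

module Determinant {ℓ} (R : CommutativeRing 0ℓ ℓ) where

  open CommutativeRing R renaming (Carrier to A)
  open import Algebra.Properties.Ring ring
    using (-0#≈0#; -‿distribˡ-*; -‿distribʳ-*; -‿+-comm; -‿involutive; +-inverseʳ-unique; //-rightDividesˡ)
  open import Algebra.Properties.CommutativeSemigroup +-commutativeSemigroup using (interchange)
  open import Relation.Binary.Reasoning.Setoid setoid
  open import Algebra.Definitions.RawSemiring (Semiring.rawSemiring semiring) using (_^_)
  open Det 1# _+_ _*_ -_ public

  Mat : ℕ → Set
  Mat n = Fin n → Fin n → A

  minor : ∀ {n} → Mat (suc n) → Fin (suc n) → Mat n
  minor M j r c = M (fsuc r) (punchIn j c)

  transpose : ∀ {n} → Mat n → Mat n
  transpose M i j = M j i

  signed-cong : ∀ k {a b} → a ≈ b → signed k a ≈ signed k b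
  signed-cong zero    a≈b = a≈b
  signed-cong (suc k) a≈b = -‿cong (signed-cong k a≈b)

  signed-0# : ∀ k → signed k 0# ≈ 0#
  signed-0# zero    = refl
  signed-0# (suc k) = trans (-‿cong (signed-0# k)) -0#≈0#

  signed-+ : ∀ k a b → signed k (a + b) ≈ signed k a + signed k b
  signed-+ zero    a b = refl
  signed-+ (suc k) a b = trans (-‿cong (signed-+ k a b)) (sym (-‿+-comm _ _))

  signed-*ˡ : ∀ k a b → signed k (a * b) ≈ signed k a * b
  signed-*ˡ zero    a b = refl
  signed-*ˡ (suc k) a b = trans (-‿cong (signed-*ˡ k a b)) (-‿distribˡ-* _ _)

  signed-*ʳ : ∀ k a b → signed k (a * b) ≈ a * signed k b
  signed-*ʳ zero    a b = refl
  signed-*ʳ (suc k) a b = trans (-‿cong (signed-*ʳ k a b)) (-‿distribʳ-* _ _)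

  signed-signed : ∀ k l a → signed k (signed l a) ≈ signed (k ℕ.+ l) a
  signed-signed zero    l a = refl
  signed-signed (suc k) l a = -‿cong (signed-signed k l a)

  signed-≡ : ∀ {k l} a → k ≡ l → signed k a ≈ signed l a
  signed-≡ a ≡.refl = refl

  sumFin-cong : ∀ n {f g : Fin (suc n) → A} → (∀ j → f j ≈ g j) → sumFin n f ≈ sumFin n g
  sumFin-cong zero    f≈g = f≈g fzero
  sumFin-cong (suc n) f≈g = +-cong (f≈g fzero) (sumFin-cong n (λ j → f≈g (fsuc j)))

  sumFin-0# : ∀ n {f : Fin (suc n) → A} → (∀ j → f j ≈ 0#) → sumFin n f ≈ 0#
  sumFin-0# zero    f≈0 = f≈0 fzero
  sumFin-0# (suc n) f≈0 =
    trans (+-cong (f≈0 fzero) (sumFin-0# n (λ j → f≈0 (fsuc j)))) (+-identityˡ 0#)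

  sumFin-+ : ∀ n (f g : Fin (suc n) → A) →
             sumFin n (λ j → f j + g j) ≈ sumFin n f + sumFin n g
  sumFin-+ zero    f g = refl
  sumFin-+ (suc n) f g = trans (+-congˡ (sumFin-+ n _ _)) (interchange _ _ _ _)

  sumFin-*ˡ : ∀ n c (f : Fin (suc n) → A) → c * sumFin n f ≈ sumFin n (λ j → c * f j)
  sumFin-*ˡ zero    c f = refl
  sumFin-*ˡ (suc n) c f = trans (distribˡ c _ _) (+-congˡ (sumFin-*ˡ n c _))

  sumFin-*ʳ : ∀ n (f : Fin (suc n) → A) c → sumFin n (λ j → f j * c) ≈ sumFin n f * c
  sumFin-*ʳ zero    f c = refl
  sumFin-*ʳ (suc n) f c = trans (+-congˡ (sumFin-*ʳ n _ c)) (sym (distribʳ c _ _))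

  sumFin-neg : ∀ n (f : Fin (suc n) → A) → sumFin n (λ j → - f j) ≈ - sumFin n f
  sumFin-neg zero    f = refl
  sumFin-neg (suc n) f = trans (+-congˡ (sumFin-neg n _)) (-‿+-comm _ _)

  signed-sumFin : ∀ k n (f : Fin (suc n) → A) →
                  signed k (sumFin n f) ≈ sumFin n (λ j → signed k (f j))
  signed-sumFin k zero    f = refl
  signed-sumFin k (suc n) f = trans (signed-+ k _ _) (+-congˡ (signed-sumFin k n _))

  det-cong : ∀ n {M N : Mat n} → (∀ i j → M i j ≈ N i j) → det n M ≈ det n N
  det-cong zero    M≈N = refl
  det-cong (suc n) M≈N = sumFin-cong n λ j → signed-cong (toℕ j)
    (*-cong (M≈N fzero j) (det-cong n (λ r c → M≈N (fsuc r) (punchIn j c))))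

  RowLinear : ∀ {n} → (Mat n → A) → Set ℓ
  RowLinear {n} D = ∀ r (M M₁ M₂ : Mat n) →
    (∀ i j → i ≢ r → M i j ≈ M₁ i j) → (∀ i j → i ≢ r → M i j ≈ M₂ i j) →
    (∀ j → M r j ≈ M₁ r j + M₂ r j) → D M ≈ D M₁ + D M₂

  AdjacentRowsVanish : ∀ {n} → (Mat n → A) → Set ℓ
  AdjacentRowsVanish {n} D = ∀ (M : Mat n) u v → toℕ v ≡ suc (toℕ u) →
    (∀ j → M u j ≈ M v j) → D M ≈ 0#

  *-splitˡ : ∀ {a a₁ a₂ d d₁ d₂} → a ≈ a₁ + a₂ → d ≈ d₁ → d ≈ d₂ → a * d ≈ a₁ * d₁ + a₂ * d₂
  *-splitˡ a≈ d≈d₁ d≈d₂ =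
    trans (*-congʳ a≈) (trans (distribʳ _ _ _) (+-cong (*-congˡ d≈d₁) (*-congˡ d≈d₂)))

  *-splitʳ : ∀ {a a₁ a₂ d d₁ d₂} → a ≈ a₁ → a ≈ a₂ → d ≈ d₁ + d₂ → a * d ≈ a₁ * d₁ + a₂ * d₂
  *-splitʳ a≈a₁ a≈a₂ d≈ =
    trans (*-congˡ d≈) (trans (distribˡ _ _ _) (+-cong (*-congʳ a≈a₁) (*-congʳ a≈a₂)))

  det-split : ∀ n (M M₁ M₂ : Mat (suc n)) →
    (∀ j → M fzero j * det n (minor M j) ≈
           M₁ fzero j * det n (minor M₁ j) + M₂ fzero j * det n (minor M₂ j)) →
    det (suc n) M ≈ det (suc n) M₁ + det (suc n) M₂
  det-split n M M₁ M₂ split =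
    trans (sumFin-cong n (λ j → trans (signed-cong (toℕ j) (split j)) (signed-+ (toℕ j) _ _)))
          (sumFin-+ n _ _)

  det-rowLinear : ∀ n → RowLinear (det n)
  det-rowLinear (suc n) fzero M M₁ M₂ M≈M₁ M≈M₂ M≈ = det-split n M M₁ M₂ λ j →
    *-splitˡ (M≈ j) (det-cong n (λ r c → M≈M₁ (fsuc r) (punchIn j c) λ ()))
                    (det-cong n (λ r c → M≈M₂ (fsuc r) (punchIn j c) λ ()))
  det-rowLinear (suc n) (fsuc r) M M₁ M₂ M≈M₁ M≈M₂ M≈ = det-split n M M₁ M₂ λ j →
    *-splitʳ (M≈M₁ fzero j λ ()) (M≈M₂ fzero j λ ())
      (det-rowLinear n r (minor M j) (minor M₁ j) (minor M₂ j)
        (λ i c i≢r → M≈M₁ (fsuc i) (punchIn j c) (λ eq → i≢r (suc-injective eq)))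
        (λ i c i≢r → M≈M₂ (fsuc i) (punchIn j c) (λ eq → i≢r (suc-injective eq)))
        (λ c → M≈ (punchIn j c)))

  det-colLinear : ∀ n → RowLinear (λ M → det n (transpose M))
  det-colLinear (suc n) c M M₁ M₂ M≈M₁ M≈M₂ M≈ =
    det-split n (transpose M) (transpose M₁) (transpose M₂) split
    where
    split : ∀ j → M j fzero * det n (minor (transpose M) j) ≈
                  M₁ j fzero * det n (minor (transpose M₁) j) + M₂ j fzero * det n (minor (transpose M₂) j)
    split j with j ≟ c
    ... | yes ≡.refl =
      *-splitˡ (M≈ fzero) (det-cong n (λ r k → M≈M₁ (punchIn j k) (fsuc r) (punchInᵢ≢i j k)))
                          (det-cong n (λ r k → M≈M₂ (punchIn j k) (fsuc r) (punchInᵢ≢i j k)))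
    ... | no j≢c = *-splitʳ (M≈M₁ j fzero j≢c) (M≈M₂ j fzero j≢c)
      (det-colLinear n (punchOut j≢c)
        (λ k r → M (punchIn j k) (fsuc r)) (λ k r → M₁ (punchIn j k) (fsuc r)) (λ k r → M₂ (punchIn j k) (fsuc r))
        (λ k r k≢ → M≈M₁ (punchIn j k) (fsuc r) (avoids k≢))
        (λ k r k≢ → M≈M₂ (punchIn j k) (fsuc r) (avoids k≢))
        (λ r → ≡.subst (λ i → M i (fsuc r) ≈ M₁ i (fsuc r) + M₂ i (fsuc r))
                       (≡.sym (punchIn-punchOut j≢c)) (M≈ (fsuc r))))
      where
      avoids : ∀ {k} → k ≢ punchOut j≢c → punchIn j k ≢ c
      avoids k≢ eq = k≢ (punchIn-injective j _ _ (≡.trans eq (≡.sym (punchIn-punchOut j≢c))))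

  -- (j , punchIn j k) ranges over the ordered pairs of distinct indices.
  sumFin-antisymmetricPairs : ∀ n (F : Fin (suc (suc n)) → Fin (suc n) → A) →
    (∀ j k k′ → punchIn (punchIn j k) k′ ≡ j → F j k ≈ - F (punchIn j k) k′) →
    sumFin (suc n) (λ j → sumFin n (F j)) ≈ 0#
  sumFin-antisymmetricPairs zero    F antisym =
    trans (+-congʳ (antisym fzero fzero fzero ≡.refl)) (-‿inverseˡ _)
  sumFin-antisymmetricPairs (suc n) F antisym = begin
    sumFin (suc n) (F fzero) + sumFin (suc n) (λ j → F (fsuc j) fzero + sumFin n (λ k → F (fsuc j) (fsuc k)))
      ≈⟨ +-cong (sumFin-cong (suc n) (λ k → antisym fzero k fzero ≡.refl))
                (sumFin-+ (suc n) (λ j → F (fsuc j) fzero) (λ j → sumFin n (λ k → F (fsuc j) (fsuc k)))) ⟩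
    sumFin (suc n) (λ k → - F (fsuc k) fzero) + (S + sumFin (suc n) (λ j → sumFin n (λ k → F (fsuc j) (fsuc k))))
      ≈⟨ +-cong (sumFin-neg (suc n) (λ k → F (fsuc k) fzero))
                (+-congˡ (sumFin-antisymmetricPairs n (λ j k → F (fsuc j) (fsuc k))
                           (λ j k k′ eq → antisym (fsuc j) (fsuc k) (fsuc k′) (≡.cong fsuc eq)))) ⟩
    - S + (S + 0#)  ≈⟨ +-congˡ (+-identityʳ S) ⟩
    - S + S         ≈⟨ -‿inverseˡ S ⟩
    0#              ∎
    where S = sumFin (suc n) (λ j → F (fsuc j) fzero)

  -- Expanding along both rows, the terms for the column pairs (j , j′) and (j′ , j) cancel.
  det-equalFirstRows : ∀ n (M : Mat (suc (suc n))) →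
    (∀ j → M fzero j ≈ M (fsuc fzero) j) → det (suc (suc n)) M ≈ 0#
  det-equalFirstRows n M M₀≈M₁ =
    trans (sumFin-cong (suc n) expand) (sumFin-antisymmetricPairs n F antisym)
    where
    D : Fin (suc (suc n)) → Fin (suc n) → A
    D j k = det n (λ r c → M (fsuc (fsuc r)) (punchIn j (punchIn k c)))

    F : Fin (suc (suc n)) → Fin (suc n) → A
    F j k = signed (toℕ j ℕ.+ toℕ k) ((M fzero j * M fzero (punchIn j k)) * D j k)

    expand : ∀ j → signed (toℕ j) (M fzero j * det (suc n) (minor M j)) ≈ sumFin n (F j)
    expand j = trans (signed-cong (toℕ j) (sumFin-*ˡ n _ _))
      (trans (signed-sumFin (toℕ j) n _) (sumFin-cong n λ k → begin
        signed (toℕ j) (M fzero j * signed (toℕ k) (M (fsuc fzero) (punchIn j k) * D j k))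
          ≈⟨ signed-cong (toℕ j) (sym (signed-*ʳ (toℕ k) _ _)) ⟩
        signed (toℕ j) (signed (toℕ k) (M fzero j * (M (fsuc fzero) (punchIn j k) * D j k)))
          ≈⟨ signed-signed (toℕ j) (toℕ k) _ ⟩
        signed (toℕ j ℕ.+ toℕ k) (M fzero j * (M (fsuc fzero) (punchIn j k) * D j k))
          ≈⟨ signed-cong (toℕ j ℕ.+ toℕ k)
               (trans (sym (*-assoc _ _ _)) (*-congʳ (*-congˡ (sym (M₀≈M₁ (punchIn j k)))))) ⟩
        F j k ∎))

    antisym : ∀ j k k′ → punchIn (punchIn j k) k′ ≡ j → F j k ≈ - F (punchIn j k) k′
    antisym j k k′ eq = opposite (punchIn-pair-parity j k k′ eq)
      where
      j′ = punchIn j k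
      Y = (M fzero j * M fzero j′) * D j k
      Y′≈Y : (M fzero j′ * M fzero (punchIn j′ k′)) * D j′ k′ ≈ Y
      Y′≈Y = *-cong (trans (*-congˡ (reflexive (≡.cong (M fzero) eq))) (*-comm _ _))
                    (det-cong n λ r c → reflexive (≡.cong (M (fsuc (fsuc r))) (≡.sym (punchIn-pair-swap j k k′ eq c))))
      opposite : toℕ j ℕ.+ toℕ k ≡ suc (toℕ j′ ℕ.+ toℕ k′) ⊎
                 suc (toℕ j ℕ.+ toℕ k) ≡ toℕ j′ ℕ.+ toℕ k′ →
                 F j k ≈ - F j′ k′
      opposite (inj₁ odd)  = trans (signed-≡ Y odd) (-‿cong (signed-cong (toℕ j′ ℕ.+ toℕ k′) (sym Y′≈Y)))
      opposite (inj₂ even) =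
        sym (trans (-‿cong (trans (signed-cong (toℕ j′ ℕ.+ toℕ k′) Y′≈Y) (signed-≡ Y (≡.sym even))))
                                        (-‿involutive _))

  det-adjacentRows : ∀ n → AdjacentRowsVanish (det n)
  det-adjacentRows (suc (suc n)) M fzero (fsuc fzero) _ Mu≈Mv = det-equalFirstRows n M Mu≈Mv
  det-adjacentRows (suc n) M (fsuc u) (fsuc v) v≡1+u Mu≈Mv = sumFin-0# n λ j →
    trans (signed-cong (toℕ j) (trans (*-congˡ (det-adjacentRows n (minor M j) u v (ℕ.suc-injective v≡1+u)
                                                  (λ c → Mu≈Mv (punchIn j c))))
                                      (zeroʳ _)))
          (signed-0# (toℕ j))

  sumFin-adjacentPair : ∀ n (f : Fin (suc n) → A) (u v : Fin (suc n)) → toℕ v ≡ suc (toℕ u) →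
    f u + f v ≈ 0# → (∀ j → j ≢ u → j ≢ v → f j ≈ 0#) → sumFin n f ≈ 0#
  sumFin-adjacentPair (suc zero) f fzero (fsuc fzero) _ pair _ = pair
  sumFin-adjacentPair (suc (suc n)) f fzero (fsuc fzero) _ pair rest =
    trans (sym (+-assoc _ _ _))
          (trans (+-cong pair (sumFin-0# n (λ j → rest (fsuc (fsuc j)) (λ ()) (λ ())))) (+-identityˡ 0#))
  sumFin-adjacentPair (suc n) f (fsuc u) (fsuc v) v≡1+u pair rest =
    trans (+-cong (rest fzero (λ ()) (λ ()))
                  (sumFin-adjacentPair n (f ∘ fsuc) u v (ℕ.suc-injective v≡1+u) pair
                    (λ j j≢u j≢v → rest (fsuc j) (j≢u ∘ suc-injective) (j≢v ∘ suc-injective))))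
          (+-identityˡ 0#)

  det-adjacentCols : ∀ n → AdjacentRowsVanish (λ M → det n (transpose M))
  det-adjacentCols (suc n) M u v v≡1+u Mu≈Mv = sumFin-adjacentPair n _ u v v≡1+u pair rest
    where
    minorᵀ : Fin (suc n) → Mat n
    minorᵀ j = minor (transpose M) j

    minors-equal : ∀ r c → minorᵀ u r c ≈ minorᵀ v r c
    minors-equal r c with punchIn-adjacent u v v≡1+u c
    ... | inj₁ eq         = reflexive (≡.cong (λ i → M i (fsuc r)) eq)
    ... | inj₂ (eq , eq′) = trans (reflexive (≡.cong (λ i → M i (fsuc r)) eq))
                                  (trans (sym (Mu≈Mv (fsuc r))) (reflexive (≡.cong (λ i → M i (fsuc r)) (≡.sym eq′))))

    pair : signed (toℕ u) (M u fzero * det n (minorᵀ u)) + signed (toℕ v) (M v fzero * det n (minorᵀ v)) ≈ 0#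
    pair = trans (+-congˡ (trans (signed-≡ _ v≡1+u)
                                 (-‿cong (signed-cong (toℕ u) (sym (*-cong (Mu≈Mv fzero) (det-cong n minors-equal)))))))
                 (-‿inverseʳ _)

    rest : ∀ j → j ≢ u → j ≢ v → signed (toℕ j) (M j fzero * det n (minorᵀ j)) ≈ 0#
    rest j j≢u j≢v = trans (signed-cong (toℕ j) (trans (*-congˡ minor-vanishes) (zeroʳ _))) (signed-0# (toℕ j))
      where
      minor-vanishes : det n (minorᵀ j) ≈ 0#
      minor-vanishes = det-adjacentCols n (transpose (minorᵀ j)) (punchOut j≢u) (punchOut j≢v)
        (punchOut-adjacent j≢u j≢v v≡1+u)
        (λ r → trans (reflexive (≡.cong (λ i → M i (fsuc r)) (punchIn-punchOut j≢u)))
                     (trans (Mu≈Mv (fsuc r)) (reflexive (≡.cong (λ i → M i (fsuc r)) (≡.sym (punchIn-punchOut j≢v))))))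

  reflexive-at : ∀ {n} {r r′ : Fin n → A} {j} → r ≡ r′ → r j ≈ r′ j
  reflexive-at r≡r′ = reflexive (≡.cong-app r≡r′ _)

  replaceRows : ∀ {n} → Mat n → Fin n → Fin n → (Fin n → A) → (Fin n → A) → Mat n
  replaceRows M u v x y = updateAt (updateAt M v (λ _ → y)) u (λ _ → x)

  module _ {n} (M : Mat n) {u v : Fin n} (x y : Fin n → A) where

    replaceRows-u : replaceRows M u v x y u ≡ x
    replaceRows-u = updateAt-updates u _

    replaceRows-v : u ≢ v → replaceRows M u v x y v ≡ y
    replaceRows-v u≢v = ≡.trans (updateAt-minimal v u _ (u≢v ∘ ≡.sym)) (updateAt-updates v M)

    replaceRows-other : ∀ {i} → i ≢ u → i ≢ v → replaceRows M u v x y i ≡ M i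
    replaceRows-other {i} i≢u i≢v = ≡.trans (updateAt-minimal i u _ i≢u) (updateAt-minimal i v M i≢v)

  replaceRows-self : ∀ {n} (M : Mat n) {u v} → u ≢ v → ∀ i → replaceRows M u v (M u) (M v) i ≡ M i
  replaceRows-self M {u} {v} u≢v i with i ≟ u | i ≟ v
  ... | yes ≡.refl | _          = replaceRows-u M _ _
  ... | no _       | yes ≡.refl = replaceRows-v M _ _ u≢v
  ... | no i≢u     | no i≢v     = replaceRows-other M _ _ i≢u i≢v

  addPartnerRows : ∀ {n} → (Fin n → Maybe (Fin n)) → Mat n → Mat n
  addPartnerRows π M i = maybe′ (λ j c → M i c + M j c) (M i) (π i)

  module AddPartnerRowsBelow {n} (π : Fin n → Maybe (Fin n)) (M : Mat n) where

    addedBelow : ℕ → Mat n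
    addedBelow t i with toℕ i ℕ.<? t
    ... | yes _ = addPartnerRows π M i
    ... | no  _ = M i

    addedBelow-n : ∀ i → addedBelow n i ≡ addPartnerRows π M i
    addedBelow-n i with toℕ i ℕ.<? n
    ... | yes _  = ≡.refl
    ... | no i≮n = ⊥-elim (i≮n (toℕ<n i))

    addedBelow-≢ : ∀ t i → toℕ i ≢ t → addedBelow (suc t) i ≡ addedBelow t i
    addedBelow-≢ t i i≢t with toℕ i ℕ.<? suc t | toℕ i ℕ.<? t
    ... | yes _     | yes _   = ≡.refl
    ... | no _      | no _    = ≡.refl
    ... | yes i<1+t | no i≮t  = ⊥-elim (i≢t (ℕ.≤-antisym (ℕ.s≤s⁻¹ i<1+t) (ℕ.≮⇒≥ i≮t)))
    ... | no i≮1+t  | yes i<t = ⊥-elim (i≮1+t (ℕ.m<n⇒m<1+n i<t))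

    addedBelow-≡ : ∀ t i → toℕ i ≡ t → addedBelow (suc t) i ≡ addPartnerRows π M i × addedBelow t i ≡ M i
    addedBelow-≡ t i i≡t with toℕ i ℕ.<? suc t | toℕ i ℕ.<? t
    ... | yes _    | no _    = ≡.refl , ≡.refl
    ... | no i≮1+t | _       = ⊥-elim (i≮1+t (≡.subst (ℕ._< suc t) (≡.sym i≡t) (ℕ.n<1+n t)))
    ... | yes _    | yes i<t = ⊥-elim (ℕ.<-irrefl i≡t i<t)

    addedBelow-unpartnered : ∀ t {i} → π i ≡ nothing → addedBelow t i ≡ M i
    addedBelow-unpartnered t {i} πi≡nothing with toℕ i ℕ.<? t
    ... | yes _ = ≡.cong (maybe′ _ _) πi≡nothing
    ... | no _  = ≡.refl

  -- Stated for an arbitrary D so as to serve both det and det ∘ transpose.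
  module Alternating (D : ∀ n → Mat n → A)
    (D-cong : ∀ n {M N : Mat n} → (∀ i j → M i j ≈ N i j) → D n M ≈ D n N)
    (D-rowLinear : ∀ n → RowLinear (D n)) (D-adjacentRows : ∀ n → AdjacentRowsVanish (D n)) where

    module _ {n} (M : Mat n) (u v : Fin n) (adjacent : toℕ v ≡ suc (toℕ u)) where

      private
        E : (Fin n → A) → (Fin n → A) → A
        E x y = D n (replaceRows M u v x y)

        u≢v : u ≢ v
        u≢v u≡v = ℕ.1+n≢n (≡.sym (≡.trans (≡.cong toℕ u≡v) adjacent))

      D-replaceRows-linearˡ : ∀ x x′ y → E (λ j → x j + x′ j) y ≈ E x y + E x′ y
      D-replaceRows-linearˡ x x′ y = D-rowLinear n u _ _ _ (outside-u x) (outside-u x′)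
        (λ j → trans (reflexive-at (replaceRows-u M _ y))
                     (sym (+-cong (reflexive-at (replaceRows-u M x y)) (reflexive-at (replaceRows-u M x′ y)))))
        where
        outside-u : ∀ z i j → i ≢ u → replaceRows M u v (λ c → x c + x′ c) y i j ≈ replaceRows M u v z y i j
        outside-u z i j i≢u = reflexive-at (≡.trans (updateAt-minimal i u _ i≢u) (≡.sym (updateAt-minimal i u _ i≢u)))

      D-replaceRows-linearʳ : ∀ x y y′ → E x (λ j → y j + y′ j) ≈ E x y + E x y′
      D-replaceRows-linearʳ x y y′ = D-rowLinear n v _ _ _ (outside-v y) (outside-v y′)
        (λ j → trans (reflexive-at (replaceRows-v M x _ u≢v))
                     (sym (+-cong (reflexive-at (replaceRows-v M x y u≢v)) (reflexive-at (replaceRows-v M x y′ u≢v)))))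
        where
        outside-v : ∀ z i j → i ≢ v → replaceRows M u v x (λ c → y c + y′ c) i j ≈ replaceRows M u v x z i j
        outside-v z i j i≢v with i ≟ u
        ... | yes ≡.refl = trans (reflexive-at (replaceRows-u M x _)) (sym (reflexive-at (replaceRows-u M x z)))
        ... | no i≢u     = reflexive-at (≡.trans (replaceRows-other M x _ i≢u i≢v)
                                                 (≡.sym (replaceRows-other M x z i≢u i≢v)))

      D-replaceRows-diagonal : ∀ x → E x x ≈ 0#
      D-replaceRows-diagonal x = D-adjacentRows n _ u v adjacent
        (λ j → trans (reflexive-at (replaceRows-u M x x)) (sym (reflexive-at (replaceRows-v M x x u≢v))))

      D-swapAdjacent : D n (replaceRows M u v (M v) (M u)) ≈ - D n M
      D-swapAdjacent = +-inverseʳ-unique (D n M) (E (M v) (M u)) (begin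
        D n M + E (M v) (M u)
          ≈⟨ +-cong (trans (sym (+-identityˡ _)) (+-congʳ (sym (D-replaceRows-diagonal (M u))))) (sym (+-identityʳ _)) ⟩
        (E (M u) (M u) + D n M) + (E (M v) (M u) + 0#)
          ≈⟨ +-cong (+-congˡ (sym (D-cong n λ i j → reflexive-at (replaceRows-self M u≢v i))))
                    (+-congˡ (sym (D-replaceRows-diagonal (M v)))) ⟩
        (E (M u) (M u) + E (M u) (M v)) + (E (M v) (M u) + E (M v) (M v))
          ≈⟨ sym (+-cong (D-replaceRows-linearʳ (M u) (M u) (M v)) (D-replaceRows-linearʳ (M v) (M u) (M v))) ⟩
        E (M u) s + E (M v) s  ≈⟨ sym (D-replaceRows-linearˡ (M u) (M v) s) ⟩
        E s s                  ≈⟨ D-replaceRows-diagonal s ⟩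
        0#                     ∎)
        where
        s : Fin n → A
        s j = M u j + M v j

    D-equalRows< : ∀ {n} (M : Mat n) a b {k} → toℕ a ℕ.<′ k → k ≡ toℕ b →
                   (∀ j → M a j ≈ M b j) → D n M ≈ 0#
    D-equalRows< M a b (ℕ.≤′-reflexive eq) eq′ Ma≈Mb = D-adjacentRows _ M a b (≡.sym (≡.trans eq eq′)) Ma≈Mb
    D-equalRows< {n} M a b {suc k} (ℕ.≤′-step a<′k) 1+k≡b Ma≈Mb = begin
      D n M             ≈⟨ sym (-‿involutive _) ⟩
      - (- D n M)       ≈⟨ -‿cong (sym (D-swapAdjacent M u b u+1≡b)) ⟩
      - D n M′          ≈⟨ -‿cong (D-equalRows< M′ a u a<′k (≡.sym (toℕ-fromℕ< k<n)) M′a≈M′u) ⟩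
      - 0#              ≈⟨ -0#≈0# ⟩
      0#                ∎
      where
      k<n : k ℕ.< n
      k<n = ℕ.<⇒≤ (≡.subst (ℕ._< n) (≡.sym 1+k≡b) (toℕ<n b))
      u : Fin n
      u = fromℕ< k<n
      u+1≡b : toℕ b ≡ suc (toℕ u)
      u+1≡b = ≡.trans (≡.sym 1+k≡b) (≡.cong suc (≡.sym (toℕ-fromℕ< k<n)))
      M′ = replaceRows M u b (M b) (M u)
      a<u : toℕ a ℕ.< toℕ u
      a<u = ≡.subst (toℕ a ℕ.<_) (≡.sym (toℕ-fromℕ< k<n)) (ℕ.<′⇒< a<′k)
      M′a≈M′u : ∀ j → M′ a j ≈ M′ u j
      M′a≈M′u j = begin
        M′ a j  ≈⟨ reflexive-at (replaceRows-other M _ _ (<⇒≢ a<u) (<⇒≢ a<b)) ⟩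
        M a j   ≈⟨ Ma≈Mb j ⟩
        M b j   ≈⟨ sym (reflexive-at (replaceRows-u M _ _)) ⟩
        M′ u j  ∎
        where
        a<b : toℕ a ℕ.< toℕ b
        a<b = ℕ.<-trans a<u (≡.subst (toℕ u ℕ.<_) (≡.sym u+1≡b) (ℕ.n<1+n _))
        <⇒≢ : ∀ {c} → toℕ a ℕ.< toℕ c → a ≢ c
        <⇒≢ a<c a≡c = ℕ.<-irrefl (≡.cong toℕ a≡c) a<c

    D-equalRows : ∀ {n} (M : Mat n) {a b} → a ≢ b → (∀ j → M a j ≈ M b j) → D n M ≈ 0#
    D-equalRows M {a} {b} a≢b Ma≈Mb with ℕ.<-cmp (toℕ a) (toℕ b)
    ... | tri< a<b _ _ = D-equalRows< M a b (ℕ.<⇒<′ a<b) ≡.refl Ma≈Mb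
    ... | tri≈ _ a≡b _ = ⊥-elim (a≢b (toℕ-injective a≡b))
    ... | tri> _ _ b<a = D-equalRows< M b a (ℕ.<⇒<′ b<a) ≡.refl (λ j → sym (Ma≈Mb j))

    D-addRow : ∀ {n} (M M′ : Mat n) {r s} → r ≢ s → (∀ i j → i ≢ r → M′ i j ≈ M i j) →
               (∀ j → M′ r j ≈ M r j + M s j) → D n M′ ≈ D n M
    D-addRow {n} M M′ {r} {s} r≢s M′≈M M′r≈ = begin
      D n M′          ≈⟨ D-rowLinear n r M′ M Mₛ M′≈M
                           (λ i j i≢r → trans (M′≈M i j i≢r) (sym (reflexive-at (updateAt-minimal i r M i≢r))))
                           (λ j → trans (M′r≈ j) (+-congˡ (sym (reflexive-at (updateAt-updates r M))))) ⟩
      D n M + D n Mₛ  ≈⟨ +-congˡ (D-equalRows Mₛ r≢s λ j →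
                           trans (reflexive-at (updateAt-updates r M))
                                 (sym (reflexive-at (updateAt-minimal s r M (r≢s ∘ ≡.sym))))) ⟩
      D n M + 0#      ≈⟨ +-identityʳ _ ⟩
      D n M           ∎
      where Mₛ = updateAt M r (λ _ → M s)

    -- The partners are added one row at a time, in increasing order of the modified row.
    D-addPartnerRows : ∀ {n} (π : Fin n → Maybe (Fin n)) → PartnersFixed π →
                       ∀ M → D n (addPartnerRows π M) ≈ D n M
    D-addPartnerRows {n} π π-fixed M =
      trans (D-cong n (λ i j → sym (reflexive-at (addedBelow-n i)))) (steps n ℕ.≤-refl)
      where
      open AddPartnerRowsBelow π M

      steps : ∀ t → t ℕ.≤ n → D n (addedBelow t) ≈ D n M
      steps zero    _   = D-cong n (λ i j → refl)
      steps (suc t) t<n = trans (step (π r) ≡.refl) (steps t (ℕ.<⇒≤ t<n))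
        where
        r = fromℕ< t<n

        unchanged : ∀ i j → i ≢ r → addedBelow (suc t) i j ≈ addedBelow t i j
        unchanged i j i≢r = reflexive-at (addedBelow-≢ t i λ i≡t →
          i≢r (toℕ-injective (≡.trans i≡t (≡.sym (toℕ-fromℕ< t<n)))))

        at-r = addedBelow-≡ t r (toℕ-fromℕ< t<n)

        step : ∀ p → π r ≡ p → D n (addedBelow (suc t)) ≈ D n (addedBelow t)
        step nothing πr≡nothing = D-cong n everywhere
          where
          everywhere : ∀ i j → addedBelow (suc t) i j ≈ addedBelow t i j
          everywhere i j with i ≟ r
          ... | yes ≡.refl = reflexive-at (≡.trans (addedBelow-unpartnered (suc t) πr≡nothing)
                                          (≡.sym (addedBelow-unpartnered t πr≡nothing)))
          ... | no i≢r     = unchanged i j i≢r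
        step (just s) πr≡s = D-addRow (addedBelow t) (addedBelow (suc t)) r≢s unchanged λ j → begin
          addedBelow (suc t) r j                 ≈⟨ reflexive-at (≡.trans (proj₁ at-r) (≡.cong (maybe′ _ _) πr≡s)) ⟩
          M r j + M s j                          ≈⟨ sym (+-cong (reflexive-at (proj₂ at-r))
                                                           (reflexive-at (addedBelow-unpartnered t (π-fixed r s πr≡s)))) ⟩
          addedBelow t r j + addedBelow t s j    ∎
          where
          r≢s : r ≢ s
          r≢s ≡.refl with () ← ≡.trans (≡.sym πr≡s) (π-fixed r s πr≡s)

  open Alternating det det-cong det-rowLinear det-adjacentRows public
    using () renaming (D-addPartnerRows to det-addPartnerRows)

  private
    module Columns = Alternating (λ n M → det n (transpose M)) (λ n M≈N → det-cong n (λ i j → M≈N j i))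
                                 det-colLinear det-adjacentCols

  det-equalCols : ∀ {n} (M : Mat n) {a b} → a ≢ b → (∀ i → M i a ≈ M i b) → det n M ≈ 0#
  det-equalCols M = Columns.D-equalRows (transpose M)

  det-addPartnerCols : ∀ {n} (π : Fin n → Maybe (Fin n)) → PartnersFixed π →
                       ∀ M → det n (transpose (addPartnerRows π (transpose M))) ≈ det n M
  det-addPartnerCols π partnerless M = Columns.D-addPartnerRows π partnerless (transpose M)

  sumFin-↑ˡ : ∀ m n (f : Fin (suc (m ℕ.+ n)) → A) → (∀ b → f (suc m ↑ʳ b) ≈ 0#) →
              sumFin (m ℕ.+ n) f ≈ sumFin m (λ a → f (a ↑ˡ n))
  sumFin-↑ˡ zero    zero    f f≈0 = refl
  sumFin-↑ˡ zero    (suc n) f f≈0 = trans (+-congˡ (sumFin-0# n f≈0)) (+-identityʳ _)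
  sumFin-↑ˡ (suc m) n       f f≈0 = +-congˡ (sumFin-↑ˡ m n (f ∘ fsuc) f≈0)

  det-blockLowerTriangular : ∀ m n (W : Mat (m ℕ.+ n)) → (∀ a b → W (a ↑ˡ n) (m ↑ʳ b) ≈ 0#) →
    det (m ℕ.+ n) W ≈ det m (λ a b → W (a ↑ˡ n) (b ↑ˡ n)) * det n (λ a b → W (m ↑ʳ a) (m ↑ʳ b))
  det-blockLowerTriangular zero    n W _       = sym (*-identityˡ _)
  det-blockLowerTriangular (suc m) n W W-upper = begin
    det (suc m ℕ.+ n) W
      ≈⟨ sumFin-↑ˡ m n _ (λ b → trans (signed-cong (toℕ (suc m ↑ʳ b)) (trans (*-congʳ (W-upper fzero b)) (zeroˡ _)))
                                      (signed-0# (toℕ (suc m ↑ʳ b)))) ⟩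
    sumFin m (λ a → signed (toℕ (a ↑ˡ n)) (W fzero (a ↑ˡ n) * det (m ℕ.+ n) (minor W (a ↑ˡ n))))
      ≈⟨ sumFin-cong m term ⟩
    sumFin m (λ a → signed (toℕ a) (TL fzero a * det m (minor TL a)) * det n BR)
      ≈⟨ sumFin-*ʳ m _ _ ⟩
    det (suc m) TL * det n BR ∎
    where
    TL : Mat (suc m)
    TL a b = W (a ↑ˡ n) (b ↑ˡ n)
    BR : Mat n
    BR a b = W (suc m ↑ʳ a) (suc m ↑ʳ b)

    minor-blocks : ∀ a → det (m ℕ.+ n) (minor W (a ↑ˡ n)) ≈ det m (minor TL a) * det n BR
    minor-blocks a = trans
      (det-blockLowerTriangular m n (minor W (a ↑ˡ n))
        (λ a′ b → trans (reflexive (≡.cong (W (fsuc (a′ ↑ˡ n))) (punchIn-↑ˡ-↑ʳ n a b))) (W-upper (fsuc a′) b)))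
      (*-cong (det-cong m (λ r c → reflexive (≡.cong (W (fsuc (r ↑ˡ n))) (punchIn-↑ˡ-↑ˡ n a c))))
              (det-cong n (λ r c → reflexive (≡.cong (W (fsuc (m ↑ʳ r))) (punchIn-↑ˡ-↑ʳ n a c)))))

    term : ∀ a → signed (toℕ (a ↑ˡ n)) (W fzero (a ↑ˡ n) * det (m ℕ.+ n) (minor W (a ↑ˡ n))) ≈
                 signed (toℕ a) (TL fzero a * det m (minor TL a)) * det n BR
    term a = trans (signed-≡ _ (toℕ-↑ˡ a n))
      (trans (signed-cong (toℕ a) (trans (*-congˡ (minor-blocks a)) (sym (*-assoc _ _ _))))
             (signed-*ˡ (toℕ a) _ _))

  det-scalar : ∀ n x (Z : Mat n) → (∀ a → Z a a ≈ x) → (∀ a b → a ≢ b → Z a b ≈ 0#) → det n Z ≈ x ^ n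
  det-scalar zero    x Z _ _ = refl
  det-scalar (suc n) x Z Z-diag Z-off = trans
    (det-blockLowerTriangular 1 n Z (λ { fzero b → Z-off fzero (fsuc b) (λ ()) }))
    (*-cong (trans (*-identityʳ _) (Z-diag fzero))
            (det-scalar n x _ (λ a → Z-diag (fsuc a)) (λ a b a≢b → Z-off _ _ (a≢b ∘ suc-injective))))

  subtractLeftCols : ∀ m → Mat (m ℕ.+ m) → Mat (m ℕ.+ m)
  subtractLeftCols m X i = (λ a → X i (a ↑ˡ m)) ++ (λ b → X i (m ↑ʳ b) - X i (b ↑ˡ m))

  module _ (m : ℕ) (X : Mat (m ℕ.+ m)) (i : Fin (m ℕ.+ m)) where

    subtractLeftCols-left : ∀ a → subtractLeftCols m X i (a ↑ˡ m) ≡ X i (a ↑ˡ m)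
    subtractLeftCols-left = lookup-++ˡ {m = m} {n = m} _ _

    subtractLeftCols-right : ∀ b → subtractLeftCols m X i (m ↑ʳ b) ≡ X i (m ↑ʳ b) - X i (b ↑ˡ m)
    subtractLeftCols-right = lookup-++ʳ {m = m} {n = m} _ _

  det-subtractLeftCols : ∀ m (X : Mat (m ℕ.+ m)) → det (m ℕ.+ m) (subtractLeftCols m X) ≈ det (m ℕ.+ m) X
  det-subtractLeftCols m X = sym (trans (det-cong (m ℕ.+ m) X≈) (det-addPartnerCols (partnerLeft m) (partnerLeft-fixed {m}) X′))
    where
    X′ = subtractLeftCols m X

    X≈ : ∀ i j → X i j ≈ addPartnerRows (partnerLeft m) (transpose X′) j i
    X≈ i j with blockIndex m j
    ... | top a = trans (sym (reflexive (subtractLeftCols-left m X i a)))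
                        (reflexive-at (≡.sym (≡.cong (maybe′ _ _) (partnerLeft-left a))))
    ... | bottom b = begin
      X i (m ↑ʳ b)                                  ≈⟨ sym (//-rightDividesˡ _ _) ⟩
      (X i (m ↑ʳ b) - X i (b ↑ˡ m)) + X i (b ↑ˡ m)  ≈⟨ sym (+-cong (reflexive (subtractLeftCols-right m X i b))
                                                                   (reflexive (subtractLeftCols-left m X i b))) ⟩
      X′ i (m ↑ʳ b) + X′ i (b ↑ˡ m)                 ≈⟨ reflexive-at (≡.sym (≡.cong (maybe′ _ _) (partnerLeft-right b))) ⟩
      addPartnerRows (partnerLeft m) (transpose X′) (m ↑ʳ b) i ∎

  -- Adding the bottom half of the rows to the top half and then subtracting the left half
  -- of the columns from the right half makes X block lower triangular.
  det-halves : ∀ m (X : Mat (m ℕ.+ m)) (Y Z : Mat m) →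
    (∀ a b → X (a ↑ˡ m) (b ↑ˡ m) + X (m ↑ʳ a) (b ↑ˡ m) ≈ Y a b) →
    (∀ a b → X (a ↑ˡ m) (m ↑ʳ b) + X (m ↑ʳ a) (m ↑ʳ b) ≈ Y a b) →
    (∀ a b → X (m ↑ʳ a) (m ↑ʳ b) - X (m ↑ʳ a) (b ↑ˡ m) ≈ Z a b) →
    det (m ℕ.+ m) X ≈ det m Y * det m Z
  det-halves m X Y Z sumˡ sumʳ diff = begin
    det n X   ≈⟨ sym (det-addPartnerRows (partnerBelow m) (partnerBelow-fixed {m}) X) ⟩
    det n X₁  ≈⟨ sym (det-subtractLeftCols m X₁) ⟩
    det n X₂  ≈⟨ det-blockLowerTriangular m m X₂ X₂-upper ⟩
    det m (λ a b → X₂ (a ↑ˡ m) (b ↑ˡ m)) * det m (λ a b → X₂ (m ↑ʳ a) (m ↑ʳ b))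
              ≈⟨ *-cong (det-cong m X₂-topLeft) (det-cong m X₂-bottomRight) ⟩
    det m Y * det m Z ∎
    where
    n = m ℕ.+ m
    X₁ = addPartnerRows (partnerBelow m) X
    X₂ = subtractLeftCols m X₁

    X₁-top : ∀ a j → X₁ (a ↑ˡ m) j ≈ X (a ↑ˡ m) j + X (m ↑ʳ a) j
    X₁-top a j = reflexive-at (≡.cong (maybe′ _ _) (partnerBelow-top a))

    X₁-bottom : ∀ b j → X₁ (m ↑ʳ b) j ≈ X (m ↑ʳ b) j
    X₁-bottom b j = reflexive-at (≡.cong (maybe′ _ _) (partnerBelow-bottom b))

    X₂-upper : ∀ a b → X₂ (a ↑ˡ m) (m ↑ʳ b) ≈ 0#
    X₂-upper a b = begin
      X₂ (a ↑ˡ m) (m ↑ʳ b)                          ≈⟨ reflexive (subtractLeftCols-right m X₁ _ b) ⟩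
      X₁ (a ↑ˡ m) (m ↑ʳ b) - X₁ (a ↑ˡ m) (b ↑ˡ m)   ≈⟨ +-cong (X₁-top a _) (-‿cong (X₁-top a _)) ⟩
      (X (a ↑ˡ m) (m ↑ʳ b) + X (m ↑ʳ a) (m ↑ʳ b)) - (X (a ↑ˡ m) (b ↑ˡ m) + X (m ↑ʳ a) (b ↑ˡ m))
                                                    ≈⟨ +-cong (sumʳ a b) (-‿cong (sumˡ a b)) ⟩
      Y a b - Y a b                                 ≈⟨ -‿inverseʳ _ ⟩
      0#                                            ∎

    X₂-topLeft : ∀ a b → X₂ (a ↑ˡ m) (b ↑ˡ m) ≈ Y a b
    X₂-topLeft a b = trans (reflexive (subtractLeftCols-left m X₁ _ b)) (trans (X₁-top a _) (sumˡ a b))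

    X₂-bottomRight : ∀ a b → X₂ (m ↑ʳ a) (m ↑ʳ b) ≈ Z a b
    X₂-bottomRight a b = trans (reflexive (subtractLeftCols-right m X₁ _ b))
                               (trans (+-cong (X₁-bottom a _) (-‿cong (X₁-bottom a _))) (diff a b))

module Polynomial where

  open import Data.Integer using (+_; _+_; _*_; -_)
  open import Data.Integer.Tactic.RingSolver using (solve-∀)
  open ≡ using (cong; cong₂)
  open ≡.≡-Reasoning

  coeff-+ₚ : ∀ p q i → coeff (p +ₚ q) i ≡ coeff p i + coeff q i
  coeff-+ₚ []      q       i       = ≡.sym (ℤ.+-identityˡ _)
  coeff-+ₚ (a ∷ p) []      i       = ≡.sym (ℤ.+-identityʳ _)
  coeff-+ₚ (a ∷ p) (b ∷ q) zero    = ≡.refl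
  coeff-+ₚ (a ∷ p) (b ∷ q) (suc i) = coeff-+ₚ p q i

  coeff-·ₚ : ∀ a p i → coeff (a ·ₚ p) i ≡ a * coeff p i
  coeff-·ₚ a []      i       = ≡.sym (ℤ.*-zeroʳ a)
  coeff-·ₚ a (b ∷ p) zero    = ≡.refl
  coeff-·ₚ a (b ∷ p) (suc i) = coeff-·ₚ a p i

  coeff-negₚ : ∀ p i → coeff (-ₚ p) i ≡ - coeff p i
  coeff-negₚ []      i       = ≡.refl
  coeff-negₚ (a ∷ p) zero    = ≡.refl
  coeff-negₚ (a ∷ p) (suc i) = coeff-negₚ p i

  coeff-∷*ₚ : ∀ a p q i → coeff ((a ∷ p) *ₚ q) i ≡ a * coeff q i + coeff (+ 0 ∷ (p *ₚ q)) i
  coeff-∷*ₚ a p q i = ≡.trans (coeff-+ₚ (a ·ₚ q) _ i) (cong (_+ _) (coeff-·ₚ a q i))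

  coeff-0∷-·ₚ : ∀ a p i → coeff (+ 0 ∷ (a ·ₚ p)) i ≡ a * coeff (+ 0 ∷ p) i
  coeff-0∷-·ₚ a p zero    = ≡.sym (ℤ.*-zeroʳ a)
  coeff-0∷-·ₚ a p (suc i) = coeff-·ₚ a p i

  coeff-*ₚ[] : ∀ p i → coeff (p *ₚ []) i ≡ + 0
  coeff-*ₚ[] []      i       = ≡.refl
  coeff-*ₚ[] (a ∷ p) zero    = ≡.refl
  coeff-*ₚ[] (a ∷ p) (suc i) = coeff-*ₚ[] p i

  coeff-*ₚ∷ : ∀ p a q i → coeff (p *ₚ (a ∷ q)) i ≡ coeff ((a ·ₚ p) +ₚ (+ 0 ∷ (p *ₚ q))) i
  coeff-*ₚ∷ []      a q zero    = ≡.refl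
  coeff-*ₚ∷ []      a q (suc i) = ≡.refl
  coeff-*ₚ∷ (b ∷ p) a q zero    = begin
    b * a + + 0   ≡⟨ ℤ.+-identityʳ _ ⟩
    b * a         ≡⟨ ℤ.*-comm b a ⟩
    a * b         ≡⟨ ℤ.+-identityʳ _ ⟨
    a * b + + 0   ∎
  coeff-*ₚ∷ (b ∷ p) a q (suc i) = begin
    coeff ((b ∷ p) *ₚ (a ∷ q)) (suc i)
      ≡⟨ coeff-∷*ₚ b p (a ∷ q) (suc i) ⟩
    b * coeff q i + coeff (p *ₚ (a ∷ q)) i
      ≡⟨ cong (λ x → b * coeff q i + x) (coeff-*ₚ∷ p a q i) ⟩
    b * coeff q i + coeff ((a ·ₚ p) +ₚ (+ 0 ∷ (p *ₚ q))) i
      ≡⟨ cong (λ x → b * coeff q i + x) (coeff-+ₚ (a ·ₚ p) (+ 0 ∷ (p *ₚ q)) i) ⟩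
    b * coeff q i + (coeff (a ·ₚ p) i + coeff (+ 0 ∷ (p *ₚ q)) i)
      ≡⟨ cong (λ x → b * coeff q i + (x + coeff (+ 0 ∷ (p *ₚ q)) i)) (coeff-·ₚ a p i) ⟩
    b * coeff q i + (a * coeff p i + coeff (+ 0 ∷ (p *ₚ q)) i)
      ≡⟨ swap-middle (b * coeff q i) (a * coeff p i) _ ⟩
    a * coeff p i + (b * coeff q i + coeff (+ 0 ∷ (p *ₚ q)) i)
      ≡⟨ cong₂ _+_ (coeff-·ₚ a p i) (coeff-∷*ₚ b p q i) ⟨
    coeff (a ·ₚ p) i + coeff ((b ∷ p) *ₚ q) i
      ≡⟨ coeff-+ₚ (a ·ₚ (b ∷ p)) (+ 0 ∷ ((b ∷ p) *ₚ q)) (suc i) ⟨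
    coeff ((a ·ₚ (b ∷ p)) +ₚ (+ 0 ∷ ((b ∷ p) *ₚ q))) (suc i) ∎
    where
    swap-middle : ∀ x y z → x + (y + z) ≡ y + (x + z)
    swap-middle = solve-∀

  -- A record around _≈ₚ_, so that unification can recover the two polynomials from a proof.
  record _≋_ (p q : Poly) : Set where
    constructor coeffwise
    field coeffs : p ≈ₚ q
  open _≋_ public

  ≋-refl : ∀ {p} → p ≋ p
  ≋-refl = coeffwise λ _ → ≡.refl

  ∷-cong : ∀ a {p q} → p ≋ q → (a ∷ p) ≋ (a ∷ q)
  ∷-cong a p≋q = coeffwise λ where
    zero    → ≡.refl
    (suc i) → coeffs p≋q i

  +ₚ-cong : ∀ {p p′ q q′} → p ≋ p′ → q ≋ q′ → (p +ₚ q) ≋ (p′ +ₚ q′)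
  +ₚ-cong {p} {p′} {q} {q′} p≋p′ q≋q′ = coeffwise λ i → begin
    coeff (p +ₚ q) i         ≡⟨ coeff-+ₚ p q i ⟩
    coeff p i + coeff q i    ≡⟨ cong₂ _+_ (coeffs p≋p′ i) (coeffs q≋q′ i) ⟩
    coeff p′ i + coeff q′ i  ≡⟨ coeff-+ₚ p′ q′ i ⟨
    coeff (p′ +ₚ q′) i       ∎

  -ₚ-cong : ∀ {p q} → p ≋ q → (-ₚ p) ≋ (-ₚ q)
  -ₚ-cong {p} {q} p≋q = coeffwise λ i →
    ≡.trans (coeff-negₚ p i) (≡.trans (cong -_ (coeffs p≋q i)) (≡.sym (coeff-negₚ q i)))

  +ₚ-assoc : ∀ p q r → ((p +ₚ q) +ₚ r) ≋ (p +ₚ (q +ₚ r))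
  +ₚ-assoc p q r = coeffwise λ i → begin
    coeff ((p +ₚ q) +ₚ r) i              ≡⟨ coeff-+ₚ (p +ₚ q) r i ⟩
    coeff (p +ₚ q) i + coeff r i         ≡⟨ cong (_+ coeff r i) (coeff-+ₚ p q i) ⟩
    (coeff p i + coeff q i) + coeff r i  ≡⟨ ℤ.+-assoc (coeff p i) _ _ ⟩
    coeff p i + (coeff q i + coeff r i)  ≡⟨ cong (λ x → coeff p i + x) (coeff-+ₚ q r i) ⟨
    coeff p i + coeff (q +ₚ r) i         ≡⟨ coeff-+ₚ p (q +ₚ r) i ⟨
    coeff (p +ₚ (q +ₚ r)) i              ∎

  +ₚ-comm : ∀ p q → (p +ₚ q) ≋ (q +ₚ p)
  +ₚ-comm p q = coeffwise λ i →
    ≡.trans (coeff-+ₚ p q i) (≡.trans (ℤ.+-comm (coeff p i) _) (≡.sym (coeff-+ₚ q p i)))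

  +ₚ-identityʳ : ∀ p → (p +ₚ []) ≋ p
  +ₚ-identityʳ p = coeffwise λ i → ≡.trans (coeff-+ₚ p [] i) (ℤ.+-identityʳ _)

  -ₚ-inverseˡ : ∀ p → ((-ₚ p) +ₚ p) ≋ []
  -ₚ-inverseˡ p = coeffwise λ i → begin
    coeff ((-ₚ p) +ₚ p) i         ≡⟨ coeff-+ₚ (-ₚ p) p i ⟩
    coeff (-ₚ p) i + coeff p i    ≡⟨ cong (_+ coeff p i) (coeff-negₚ p i) ⟩
    - coeff p i + coeff p i       ≡⟨ ℤ.+-inverseˡ (coeff p i) ⟩
    + 0                           ∎

  *ₚ-congʳ : ∀ p {q q′} → q ≋ q′ → (p *ₚ q) ≋ (p *ₚ q′)
  *ₚ-congʳ []      q≋q′ = ≋-refl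
  *ₚ-congʳ (a ∷ p) {q} {q′} q≋q′ = coeffwise λ i → begin
    coeff ((a ∷ p) *ₚ q) i
      ≡⟨ coeff-∷*ₚ a p q i ⟩
    a * coeff q i + coeff (+ 0 ∷ (p *ₚ q)) i
      ≡⟨ cong₂ _+_ (cong (a *_) (coeffs q≋q′ i)) (coeffs (∷-cong (+ 0) (*ₚ-congʳ p q≋q′)) i) ⟩
    a * coeff q′ i + coeff (+ 0 ∷ (p *ₚ q′)) i
      ≡⟨ coeff-∷*ₚ a p q′ i ⟨
    coeff ((a ∷ p) *ₚ q′) i ∎

  *ₚ-comm : ∀ p q → (p *ₚ q) ≋ (q *ₚ p)
  *ₚ-comm []      q = coeffwise λ i → ≡.sym (coeff-*ₚ[] q i)
  *ₚ-comm (a ∷ p) q = coeffwise λ i →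
    ≡.trans (coeffs (+ₚ-cong (≋-refl {a ·ₚ q}) (∷-cong (+ 0) (*ₚ-comm p q))) i) (≡.sym (coeff-*ₚ∷ q a p i))

  *ₚ-distribʳ : ∀ r p q → ((p +ₚ q) *ₚ r) ≋ ((p *ₚ r) +ₚ (q *ₚ r))
  *ₚ-distribʳ r []      q       = ≋-refl
  *ₚ-distribʳ r (a ∷ p) []      = coeffwise λ i → ≡.sym (coeffs (+ₚ-identityʳ ((a ∷ p) *ₚ r)) i)
  *ₚ-distribʳ r (a ∷ p) (b ∷ q) = coeffwise λ i → let c = coeff r i in begin
    coeff (((a + b) ∷ (p +ₚ q)) *ₚ r) i
      ≡⟨ coeff-∷*ₚ (a + b) (p +ₚ q) r i ⟩
    (a + b) * c + coeff (+ 0 ∷ ((p +ₚ q) *ₚ r)) i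
      ≡⟨ cong (λ x → (a + b) * c + x) (coeffs (∷-cong (+ 0) (*ₚ-distribʳ r p q)) i) ⟩
    (a + b) * c + coeff (+ 0 ∷ ((p *ₚ r) +ₚ (q *ₚ r))) i
      ≡⟨ cong (λ x → (a + b) * c + x) (coeff-+ₚ (+ 0 ∷ (p *ₚ r)) (+ 0 ∷ (q *ₚ r)) i) ⟩
    (a + b) * c + (coeff (+ 0 ∷ (p *ₚ r)) i + coeff (+ 0 ∷ (q *ₚ r)) i)
      ≡⟨ regroup a b c _ _ ⟩
    (a * c + coeff (+ 0 ∷ (p *ₚ r)) i) + (b * c + coeff (+ 0 ∷ (q *ₚ r)) i)
      ≡⟨ cong₂ _+_ (coeff-∷*ₚ a p r i) (coeff-∷*ₚ b q r i) ⟨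
    coeff ((a ∷ p) *ₚ r) i + coeff ((b ∷ q) *ₚ r) i
      ≡⟨ coeff-+ₚ ((a ∷ p) *ₚ r) ((b ∷ q) *ₚ r) i ⟨
    coeff (((a ∷ p) *ₚ r) +ₚ ((b ∷ q) *ₚ r)) i ∎
    where
    regroup : ∀ a b c x y → (a + b) * c + (x + y) ≡ (a * c + x) + (b * c + y)
    regroup = solve-∀

  *ₚ-·ₚ : ∀ a p q → ((a ·ₚ p) *ₚ q) ≋ (a ·ₚ (p *ₚ q))
  *ₚ-·ₚ a []      q = ≋-refl
  *ₚ-·ₚ a (b ∷ p) q = coeffwise λ i → begin
    coeff ((a * b ∷ (a ·ₚ p)) *ₚ q) i
      ≡⟨ coeff-∷*ₚ (a * b) (a ·ₚ p) q i ⟩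
    (a * b) * coeff q i + coeff (+ 0 ∷ ((a ·ₚ p) *ₚ q)) i
      ≡⟨ cong (λ x → (a * b) * coeff q i + x) (coeffs (∷-cong (+ 0) (*ₚ-·ₚ a p q)) i) ⟩
    (a * b) * coeff q i + coeff (+ 0 ∷ (a ·ₚ (p *ₚ q))) i
      ≡⟨ cong (λ x → (a * b) * coeff q i + x) (coeff-0∷-·ₚ a (p *ₚ q) i) ⟩
    (a * b) * coeff q i + a * coeff (+ 0 ∷ (p *ₚ q)) i
      ≡⟨ factor a b _ _ ⟩
    a * (b * coeff q i + coeff (+ 0 ∷ (p *ₚ q)) i)
      ≡⟨ cong (a *_) (coeff-∷*ₚ b p q i) ⟨
    a * coeff ((b ∷ p) *ₚ q) i
      ≡⟨ coeff-·ₚ a ((b ∷ p) *ₚ q) i ⟨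
    coeff (a ·ₚ ((b ∷ p) *ₚ q)) i ∎
    where
    factor : ∀ a b x y → (a * b) * x + a * y ≡ a * (b * x + y)
    factor = solve-∀

  0∷-*ₚ : ∀ p q → ((+ 0 ∷ p) *ₚ q) ≋ (+ 0 ∷ (p *ₚ q))
  0∷-*ₚ p q = coeffwise λ i → ≡.trans (coeff-∷*ₚ (+ 0) p q i)
    (≡.trans (cong (_+ coeff (+ 0 ∷ (p *ₚ q)) i) (ℤ.*-zeroˡ (coeff q i))) (ℤ.+-identityˡ _))

  *ₚ-identityˡ : ∀ p → (constₚ (+ 1) *ₚ p) ≋ p
  *ₚ-identityˡ p = coeffwise λ i → begin
    coeff (constₚ (+ 1) *ₚ p) i           ≡⟨ coeff-∷*ₚ (+ 1) [] p i ⟩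
    + 1 * coeff p i + coeff (+ 0 ∷ []) i  ≡⟨ cong₂ _+_ (ℤ.*-identityˡ (coeff p i)) (coeff-0 i) ⟩
    coeff p i + + 0                       ≡⟨ ℤ.+-identityʳ _ ⟩
    coeff p i                             ∎
    where
    coeff-0 : ∀ i → coeff (+ 0 ∷ []) i ≡ + 0
    coeff-0 zero    = ≡.refl
    coeff-0 (suc i) = ≡.refl

module PolynomialRing where

  open Polynomial
  open import Data.Integer using (+_)

  ≋-setoid : Setoid 0ℓ 0ℓ
  ≋-setoid = record
    { Carrier = Poly
    ; _≈_ = _≋_
    ; isEquivalence = record
      { refl  = ≋-refl
      ; sym   = λ p≋q → coeffwise λ i → ≡.sym (coeffs p≋q i)
      ; trans = λ p≋q q≋r → coeffwise λ i → ≡.trans (coeffs p≋q i) (coeffs q≋r i)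
      }
    }

  open import Relation.Binary.Reasoning.Setoid ≋-setoid

  *ₚ-assoc : ∀ p q r → ((p *ₚ q) *ₚ r) ≋ (p *ₚ (q *ₚ r))
  *ₚ-assoc []      q r = ≋-refl
  *ₚ-assoc (a ∷ p) q r = begin
    ((a ·ₚ q) +ₚ (+ 0 ∷ (p *ₚ q))) *ₚ r          ≈⟨ *ₚ-distribʳ r (a ·ₚ q) (+ 0 ∷ (p *ₚ q)) ⟩
    ((a ·ₚ q) *ₚ r) +ₚ ((+ 0 ∷ (p *ₚ q)) *ₚ r)   ≈⟨ +ₚ-cong (*ₚ-·ₚ a q r) (0∷-*ₚ (p *ₚ q) r) ⟩
    (a ·ₚ (q *ₚ r)) +ₚ (+ 0 ∷ ((p *ₚ q) *ₚ r))   ≈⟨ +ₚ-cong ≋-refl (∷-cong (+ 0) (*ₚ-assoc p q r)) ⟩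
    (a ·ₚ (q *ₚ r)) +ₚ (+ 0 ∷ (p *ₚ (q *ₚ r)))   ∎

  *ₚ-cong : ∀ {p p′ q q′} → p ≋ p′ → q ≋ q′ → (p *ₚ q) ≋ (p′ *ₚ q′)
  *ₚ-cong {p} {p′} {q} {q′} p≋p′ q≋q′ = begin
    p *ₚ q    ≈⟨ *ₚ-congʳ p q≋q′ ⟩
    p *ₚ q′   ≈⟨ *ₚ-comm p q′ ⟩
    q′ *ₚ p   ≈⟨ *ₚ-congʳ q′ p≋p′ ⟩
    q′ *ₚ p′  ≈⟨ *ₚ-comm q′ p′ ⟩
    p′ *ₚ q′  ∎

  polynomialRing : CommutativeRing 0ℓ 0ℓ
  polynomialRing = record
    { Carrier = Poly
    ; _≈_ = _≋_
    ; _+_ = _+ₚ_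
    ; _*_ = _*ₚ_
    ; -_ = -ₚ_
    ; 0# = []
    ; 1# = constₚ (+ 1)
    ; isCommutativeRing = record
      { isRing = record
        { +-isAbelianGroup = record
          { isGroup = record
            { isMonoid = record
              { isSemigroup = record
                { isMagma = record { isEquivalence = Setoid.isEquivalence ≋-setoid ; ∙-cong = +ₚ-cong }
                ; assoc = +ₚ-assoc
                }
              ; identity = (λ p → ≋-refl) , +ₚ-identityʳ
              }
            ; inverse = comm∧invˡ⇒inv +ₚ-comm -ₚ-inverseˡ
            ; ⁻¹-cong = -ₚ-cong
            }
          ; comm = +ₚ-comm
          }
        ; *-cong = *ₚ-cong
        ; *-assoc = *ₚ-assoc
        ; *-identity = comm∧idˡ⇒id *ₚ-comm *ₚ-identityˡ
        ; distrib = comm∧distrʳ⇒distr +ₚ-cong *ₚ-comm *ₚ-distribʳ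
        }
      ; *-comm = *ₚ-comm
      }
    }
    where open import Algebra.Consequences.Setoid ≋-setoid

module Indicator where

  open import Data.Nat using (_+_; _%_)
  open ≡ using (refl; cong)

  ifEqual : {X : Set} → ℕ → ℕ → X → X → X
  ifEqual x y a b with x ℕ.≟ y
  ... | yes _ = a
  ... | no  _ = b

  ifEqual-≡ : ∀ {X : Set} {x y} {a b : X} → x ≡ y → ifEqual x y a b ≡ a
  ifEqual-≡ {x = x} {y} x≡y with x ℕ.≟ y
  ... | yes _   = refl
  ... | no x≢y  = ⊥-elim (x≢y x≡y)

  ifEqual-≢ : ∀ {X : Set} {x y} {a b : X} → x ≢ y → ifEqual x y a b ≡ b
  ifEqual-≢ {x = x} {y} x≢y with x ℕ.≟ y
  ... | yes x≡y = ⊥-elim (x≢y x≡y)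
  ... | no _    = refl

  ifEqual-+ : ∀ {X : Set} m x y {a b : X} → ifEqual (m + x) (m + y) a b ≡ ifEqual x y a b
  ifEqual-+ m x y with x ℕ.≟ y
  ... | yes x≡y = ifEqual-≡ (cong (m +_) x≡y)
  ... | no x≢y  = ifEqual-≢ (x≢y ∘ ℕ.+-cancelˡ-≡ m x y)

  ifEqual-+< : ∀ {X : Set} m x {y} {a b : X} → y ℕ.< m → ifEqual (m + x) y a b ≡ b
  ifEqual-+< m x y<m = ifEqual-≢ (λ m+x≡y → ℕ.<⇒≱ y<m (≡.subst (m ℕ.≤_) m+x≡y (ℕ.m≤m+n m x)))

  ifEqual-<+ : ∀ {X : Set} m {x} y {a b : X} → x ℕ.< m → ifEqual x (m + y) a b ≡ b
  ifEqual-<+ m y x<m = ifEqual-≢ (λ x≡m+y → ℕ.<⇒≱ x<m (≡.subst (m ℕ.≤_) (≡.sym x≡m+y) (ℕ.m≤m+n m y)))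

  hits-ifEqual : ∀ m ν (j : Fin (suc m)) → hits m ν j ≡ ifEqual (T ν % suc m) (toℕ j) 1 0
  hits-ifEqual m ν j with T ν % suc m ℕ.≟ toℕ j
  ... | yes _ = refl
  ... | no  _ = refl

  δ-ifEqual : ∀ {n} (i j : Fin n) → δ i j ≡ ifEqual (toℕ i) (toℕ j) (Xpow 1) []
  δ-ifEqual i j with toℕ i ℕ.≟ toℕ j
  ... | yes _ = refl
  ... | no  _ = refl

module Collatz where

  open import Data.Nat using (_+_; _*_; _∸_; _<_; s≤s; z≤n; _<?_)
  open import Data.Nat.DivMod
  open import Data.Nat.Divisibility using (_∣_; divides)
  open import Data.Nat.Tactic.RingSolver using (solve-∀)
  open ≡ using (refl; cong; cong₂)
  open Indicator

  T-even : ∀ ν → ν % 2 ≡ 0 → T ν ≡ ν / 2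
  T-even ν ν%2≡0 with ν % 2
  ... | zero = refl

  T-odd : ∀ ν → ν % 2 ≡ 1 → T ν ≡ (3 * ν + 1) / 2
  T-odd ν ν%2≡1 with ν % 2
  T-odd ν refl | suc zero = refl

  mod2-cases : ∀ ν → ν % 2 ≡ 0 ⊎ ν % 2 ≡ 1
  mod2-cases ν with ν % 2 | m%n<n ν 2
  ... | zero          | _ = inj₁ refl
  ... | suc zero      | _ = inj₂ refl
  ... | suc (suc _)   | s≤s (s≤s ())

  module Doubling (m′ : ℕ) where

    m = suc m′
    N = m + m

    N≡m*2 : N ≡ m * 2
    N≡m*2 = ≡.trans (cong (m +_) (≡.sym (ℕ.+-identityʳ m))) (ℕ.*-comm 2 m)

    2∣N : 2 ∣ N
    2∣N = divides m N≡m*2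

    N/2≡m : N / 2 ≡ m
    N/2≡m = ≡.trans (cong (_/ 2) N≡m*2) (m*n/n≡m m 2)

    %2-+N : ∀ ν → (ν + N) % 2 ≡ ν % 2
    %2-+N ν = %-remove-+ʳ ν 2∣N

    -- Adding N to ν keeps its parity and adds m or 3m to T ν.
    T-+N : ∀ ν → T (ν + N) % N ≡ (T ν + m) % N
    T-+N ν with mod2-cases ν
    ... | inj₁ even = cong (_% N) (begin
      T (ν + N)       ≡⟨ T-even (ν + N) (≡.trans (%2-+N ν) even) ⟩
      (ν + N) / 2     ≡⟨ +-distrib-/-∣ʳ ν 2∣N ⟩
      ν / 2 + N / 2   ≡⟨ cong₂ _+_ (≡.sym (T-even ν even)) N/2≡m ⟩
      T ν + m         ∎)
      where open ≡.≡-Reasoning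
    ... | inj₂ odd = begin
      T (ν + N) % N                          ≡⟨ cong (_% N) (T-odd (ν + N) (≡.trans (%2-+N ν) odd)) ⟩
      ((3 * (ν + N) + 1) / 2) % N            ≡⟨ cong (λ x → (x / 2) % N) (regroup ν m′) ⟩
      ((3 * ν + 1 + m * 3 * 2) / 2) % N      ≡⟨ cong (_% N) (+-distrib-/-∣ʳ (3 * ν + 1) (divides (m * 3) refl)) ⟩
      ((3 * ν + 1) / 2 + m * 3 * 2 / 2) % N  ≡⟨ cong (λ x → ((3 * ν + 1) / 2 + x) % N) (m*n/n≡m (m * 3) 2) ⟩
      ((3 * ν + 1) / 2 + m * 3) % N          ≡⟨ cong (λ x → (x + m * 3) % N) (≡.sym (T-odd ν odd)) ⟩
      (T ν + m * 3) % N
        ≡⟨ cong (_% N) (≡.trans (cong (T ν +_) (m*3 m′)) (≡.sym (ℕ.+-assoc (T ν) m N))) ⟩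
      (T ν + m + N) % N                      ≡⟨ [m+n]%n≡m%n (T ν + m) N ⟩
      (T ν + m) % N                          ∎
      where
      open ≡.≡-Reasoning
      regroup : ∀ ν m′ → 3 * (ν + (suc m′ + suc m′)) + 1 ≡ 3 * ν + 1 + suc m′ * 3 * 2
      regroup = solve-∀
      m*3 : ∀ m′ → suc m′ * 3 ≡ suc m′ + (suc m′ + suc m′)
      m*3 = solve-∀

    m∣N : m ∣ N
    m∣N = divides 2 (≡.trans N≡m*2 (ℕ.*-comm m 2))

    m<N : m < N
    m<N = ℕ.m<m+n m (s≤s z≤n)

    %-halves : ∀ t → (t % N ≡ t % m × (t + m) % N ≡ m + t % m) ⊎ (t % N ≡ m + t % m × (t + m) % N ≡ t % m)
    %-halves t with t % N <? m
    ... | yes s<m = inj₁ (≡.sym t%m≡s , (begin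
      (t + m) % N       ≡⟨ +m-% ⟩
      (s + m) % N       ≡⟨ m<n⇒m%n≡m (ℕ.+-monoˡ-< m s<m) ⟩
      s + m             ≡⟨ ℕ.+-comm s m ⟩
      m + s             ≡⟨ cong (m +_) t%m≡s ⟨
      m + t % m         ∎))
      where
      open ≡.≡-Reasoning
      s = t % N
      t%m≡s : t % m ≡ s
      t%m≡s = ≡.trans (≡.sym (m∣n⇒o%n%m≡o%m m N t m∣N)) (m<n⇒m%n≡m s<m)
      +m-% : (t + m) % N ≡ (s + m) % N
      +m-% = ≡.trans (%-distribˡ-+ t m N) (cong (λ x → (s + x) % N) (m<n⇒m%n≡m m<N))
    ... | no s≮m = inj₂ (≡.trans (≡.sym m+s′≡s) (cong (m +_) (≡.sym t%m≡s′)) , (begin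
      (t + m) % N       ≡⟨ %-distribˡ-+ t m N ⟩
      (s + m % N) % N   ≡⟨ cong (λ x → (x + m % N) % N) (≡.sym m+s′≡s) ⟩
      ((m + s′) + m % N) % N ≡⟨ cong (λ x → ((m + s′) + x) % N) (m<n⇒m%n≡m m<N) ⟩
      ((m + s′) + m) % N ≡⟨ cong (_% N) (swap m s′) ⟩
      (s′ + N) % N      ≡⟨ [m+n]%n≡m%n s′ N ⟩
      s′ % N            ≡⟨ m<n⇒m%n≡m (ℕ.<-trans s′<m m<N) ⟩
      s′                ≡⟨ t%m≡s′ ⟨
      t % m             ∎))
      where
      open ≡.≡-Reasoning
      s = t % N
      s′ = s ∸ m
      m+s′≡s : m + s′ ≡ s
      m+s′≡s = ℕ.m+[n∸m]≡n (ℕ.≮⇒≥ s≮m)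
      s′<m : s′ < m
      s′<m = ℕ.+-cancelˡ-< m s′ m (≡.subst (_< N) (≡.sym m+s′≡s) (m%n<n t N))
      t%m≡s′ : t % m ≡ s′
      t%m≡s′ = begin
        t % m          ≡⟨ m∣n⇒o%n%m≡o%m m N t m∣N ⟨
        s % m          ≡⟨ cong (_% m) (≡.trans (≡.sym m+s′≡s) (ℕ.+-comm m s′)) ⟩
        (s′ + m) % m   ≡⟨ [m+n]%n≡m%n s′ m ⟩
        s′ % m         ≡⟨ m<n⇒m%n≡m s′<m ⟩
        s′             ∎
      swap : ∀ a b → (a + b) + a ≡ b + (a + a)
      swap = solve-∀

    ifEqual-pair : ∀ t y → ifEqual (t % N) y 1 0 + ifEqual ((t + m) % N) y 1 0 ≡
                           ifEqual (t % m) y 1 0 + ifEqual (m + t % m) y 1 0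
    ifEqual-pair t y with %-halves t
    ... | inj₁ (eq₁ , eq₂) rewrite eq₁ | eq₂ = refl
    ... | inj₂ (eq₁ , eq₂) rewrite eq₁ | eq₂ = ℕ.+-comm (ifEqual (m + t % m) y 1 0) _

    C-double : ∀ (i j : Fin N) →
               C N i j ≡ ifEqual (T (toℕ i) % m) (toℕ j) 1 0 + ifEqual (m + T (toℕ i) % m) (toℕ j) 1 0
    C-double i j = begin
      C N i j
        ≡⟨ cong₂ _+_ (hits-ifEqual _ ν j) (hits-ifEqual _ (ν + N) j) ⟩
      ifEqual (T ν % N) (toℕ j) 1 0 + ifEqual (T (ν + N) % N) (toℕ j) 1 0
        ≡⟨ cong (λ x → ifEqual (T ν % N) (toℕ j) 1 0 + ifEqual x (toℕ j) 1 0) (T-+N ν) ⟩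
      ifEqual (T ν % N) (toℕ j) 1 0 + ifEqual ((T ν + m) % N) (toℕ j) 1 0
        ≡⟨ ifEqual-pair (T ν) (toℕ j) ⟩
      ifEqual (T ν % m) (toℕ j) 1 0 + ifEqual (m + T ν % m) (toℕ j) 1 0 ∎
      where
      open ≡.≡-Reasoning
      ν = toℕ i

    C-left : ∀ (i : Fin N) (b : Fin m) → C N i (b ↑ˡ m) ≡ ifEqual (T (toℕ i) % m) (toℕ b) 1 0
    C-left i b = begin
      C N i (b ↑ˡ m)
        ≡⟨ C-double i (b ↑ˡ m) ⟩
      ifEqual r (toℕ (b ↑ˡ m)) 1 0 + ifEqual (m + r) (toℕ (b ↑ˡ m)) 1 0
        ≡⟨ cong (λ y → ifEqual r y 1 0 + ifEqual (m + r) y 1 0) (toℕ-↑ˡ b m) ⟩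
      ifEqual r (toℕ b) 1 0 + ifEqual (m + r) (toℕ b) 1 0
        ≡⟨ cong (ifEqual r (toℕ b) 1 0 +_) (ifEqual-+< m r (toℕ<n b)) ⟩
      ifEqual r (toℕ b) 1 0 + 0
        ≡⟨ ℕ.+-identityʳ _ ⟩
      ifEqual r (toℕ b) 1 0 ∎
      where
      open ≡.≡-Reasoning
      r = T (toℕ i) % m

    C-right : ∀ (i : Fin N) (b : Fin m) → C N i (m ↑ʳ b) ≡ ifEqual (T (toℕ i) % m) (toℕ b) 1 0
    C-right i b = begin
      C N i (m ↑ʳ b)
        ≡⟨ C-double i (m ↑ʳ b) ⟩
      ifEqual r (toℕ (m ↑ʳ b)) 1 0 + ifEqual (m + r) (toℕ (m ↑ʳ b)) 1 0
        ≡⟨ cong (λ y → ifEqual r y 1 0 + ifEqual (m + r) y 1 0) (toℕ-↑ʳ m b) ⟩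
      ifEqual r (m + toℕ b) 1 0 + ifEqual (m + r) (m + toℕ b) 1 0
        ≡⟨ cong₂ _+_ (ifEqual-<+ m (toℕ b) (m%n<n (T (toℕ i)) m))
                     (ifEqual-+ m r (toℕ b)) ⟩
      ifEqual r (toℕ b) 1 0 ∎
      where
      open ≡.≡-Reasoning
      r = T (toℕ i) % m

    C-columns : ∀ (i : Fin N) (b : Fin m) → C N i (m ↑ʳ b) ≡ C N i (b ↑ˡ m)
    C-columns i b = ≡.trans (C-right i b) (≡.sym (C-left i b))

    C-rows : ∀ (a b : Fin m) → C N (a ↑ˡ m) (b ↑ˡ m) + C N (m ↑ʳ a) (b ↑ˡ m) ≡ C m a b
    C-rows a b = begin
      C N (a ↑ˡ m) (b ↑ˡ m) + C N (m ↑ʳ a) (b ↑ˡ m)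
        ≡⟨ cong₂ _+_ (C-left (a ↑ˡ m) b) (C-left (m ↑ʳ a) b) ⟩
      ifEqual (T (toℕ (a ↑ˡ m)) % m) (toℕ b) 1 0 + ifEqual (T (toℕ (m ↑ʳ a)) % m) (toℕ b) 1 0
        ≡⟨ cong₂ (λ x y → ifEqual (T x % m) (toℕ b) 1 0 + ifEqual (T y % m) (toℕ b) 1 0)
                 (toℕ-↑ˡ a m) (≡.trans (toℕ-↑ʳ m a) (ℕ.+-comm m (toℕ a))) ⟩
      ifEqual (T (toℕ a) % m) (toℕ b) 1 0 + ifEqual (T (toℕ a + m) % m) (toℕ b) 1 0
        ≡⟨ cong₂ _+_ (hits-ifEqual m′ (toℕ a) b) (hits-ifEqual m′ (toℕ a + m) b) ⟨
      C m a b ∎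
      where open ≡.≡-Reasoning

module CharacteristicPolynomial where

  open import Data.Integer using (+_)
  open Polynomial using (coeffwise; ∷-cong; 0∷-*ₚ; *ₚ-identityˡ)
  open PolynomialRing using (polynomialRing)
  open CommutativeRing polynomialRing
  open import Algebra.Properties.Ring ring using (-0#≈0#; -‿+-comm)
  open import Algebra.Properties.CommutativeSemigroup +-commutativeSemigroup using (interchange)
  open import Algebra.Definitions.RawSemiring (Semiring.rawSemiring semiring) using (_^_)
  open import Relation.Binary.Reasoning.Setoid setoid
  open Determinant polynomialRing using (det; det-halves; det-scalar)
  open Indicator using (ifEqual; ifEqual-≡; ifEqual-≢; ifEqual-+; ifEqual-+<; ifEqual-<+; δ-ifEqual)

  Xpow-+ : ∀ a b → Xpow a * Xpow b ≈ Xpow (a ℕ.+ b)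
  Xpow-+ zero    b = *ₚ-identityˡ (Xpow b)
  Xpow-+ (suc a) b = begin
    (+ 0 ∷ Xpow a) * Xpow b    ≈⟨ 0∷-*ₚ (Xpow a) (Xpow b) ⟩
    + 0 ∷ (Xpow a * Xpow b)    ≈⟨ ∷-cong (+ 0) (Xpow-+ a b) ⟩
    + 0 ∷ Xpow (a ℕ.+ b)       ∎

  Xpow1^ : ∀ n → Xpow 1 ^ n ≈ Xpow n
  Xpow1^ zero    = refl
  Xpow1^ (suc n) = begin
    Xpow 1 * Xpow 1 ^ n   ≈⟨ *-congˡ {Xpow 1} (Xpow1^ n) ⟩
    Xpow 1 * Xpow n       ≈⟨ Xpow-+ 1 n ⟩
    Xpow (suc n)          ∎

  constₚ-+ : ∀ x y → constₚ (+ (x ℕ.+ y)) ≈ constₚ (+ x) + constₚ (+ y)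
  constₚ-+ x y = coeffwise λ where
    zero    → ℤ.pos-+ x y
    (suc i) → ≡.refl

  -- x I − M; in particular P N is det N (charMatrix (C N)) by definition.
  charMatrix : ∀ {n} → (Fin n → Fin n → ℕ) → Fin n → Fin n → Poly
  charMatrix M i j = δ i j - constₚ (+ M i j)

  δ-at : ∀ {n} {i j : Fin n} {x y} → toℕ i ≡ x → toℕ j ≡ y → δ i j ≡ ifEqual x y (Xpow 1) []
  δ-at {i = i} {j} ≡.refl ≡.refl = δ-ifEqual i j

  module _ {m : ℕ} (a b : Fin m) where

    δ-top-top : δ (a ↑ˡ m) (b ↑ˡ m) ≡ δ a b
    δ-top-top = ≡.trans (δ-at (toℕ-↑ˡ a m) (toℕ-↑ˡ b m)) (≡.sym (δ-ifEqual a b))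

    δ-bottom-bottom : δ (m ↑ʳ a) (m ↑ʳ b) ≡ δ a b
    δ-bottom-bottom = ≡.trans (δ-at (toℕ-↑ʳ m a) (toℕ-↑ʳ m b))
                              (≡.trans (ifEqual-+ m (toℕ a) (toℕ b)) (≡.sym (δ-ifEqual a b)))

    δ-bottom-top : δ (m ↑ʳ a) (b ↑ˡ m) ≡ []
    δ-bottom-top = ≡.trans (δ-at (toℕ-↑ʳ m a) (toℕ-↑ˡ b m)) (ifEqual-+< m (toℕ a) (toℕ<n b))

    δ-top-bottom : δ (a ↑ˡ m) (m ↑ʳ b) ≡ []
    δ-top-bottom = ≡.trans (δ-at (toℕ-↑ˡ a m) (toℕ-↑ʳ m b)) (ifEqual-<+ m (toℕ b) (toℕ<n a))

  δ-diagonal : ∀ {n} (a : Fin n) → δ a a ≡ Xpow 1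
  δ-diagonal a = ≡.trans (δ-ifEqual a a) (ifEqual-≡ {a = Xpow 1} {[]} ≡.refl)

  δ-offDiagonal : ∀ {n} {a b : Fin n} → a ≢ b → δ a b ≡ []
  δ-offDiagonal {a = a} {b} a≢b = ≡.trans (δ-ifEqual a b) (ifEqual-≢ (a≢b ∘ toℕ-injective))

  det-δ : ∀ n → det n δ ≈ Xpow n
  det-δ n = trans (det-scalar n (Xpow 1) δ (λ a → reflexive (δ-diagonal a)) (λ a b a≢b → reflexive (δ-offDiagonal a≢b)))
                  (Xpow1^ n)

  [p-r]+[q-s]≈[p+q]-[r+s] : ∀ p q r s → (p - r) + (q - s) ≈ (p + q) - (r + s)
  [p-r]+[q-s]≈[p+q]-[r+s] p q r s = trans (interchange p (- r) q (- s)) (+-congˡ (-‿+-comm r s))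

  [p-r]-[q-r]≈p-q : ∀ p q r → (p - r) - (q - r) ≈ p - q
  [p-r]-[q-r]≈p-q p q r = begin
    (p - r) - (q - r)          ≈⟨ +-congˡ (sym (-‿+-comm q (- r))) ⟩
    (p - r) + (- q + - - r)    ≈⟨ interchange p (- r) (- q) (- - r) ⟩
    (p - q) + (- r + - - r)    ≈⟨ +-congˡ (-‿inverseʳ (- r)) ⟩
    (p - q) + 0#               ≈⟨ +-identityʳ (p - q) ⟩
    p - q                      ∎

  module _ (m : ℕ) (M : Fin (m ℕ.+ m) → Fin (m ℕ.+ m) → ℕ) (M′ : Fin m → Fin m → ℕ)
           (M-cols : ∀ i b → M i (m ↑ʳ b) ≡ M i (b ↑ˡ m))
           (M-rows : ∀ a b → M (a ↑ˡ m) (b ↑ˡ m) ℕ.+ M (m ↑ʳ a) (b ↑ˡ m) ≡ M′ a b) where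

    private
      c : ℕ → Poly
      c x = constₚ (+ x)

    charMatrix-+ : ∀ i i′ j → charMatrix M i j + charMatrix M i′ j ≈ (δ i j + δ i′ j) - c (M i j ℕ.+ M i′ j)
    charMatrix-+ i i′ j = begin
      (δ i j - c (M i j)) + (δ i′ j - c (M i′ j))  ≈⟨ [p-r]+[q-s]≈[p+q]-[r+s] (δ i j) (δ i′ j) (c (M i j)) (c (M i′ j)) ⟩
      (δ i j + δ i′ j) - (c (M i j) + c (M i′ j))
        ≈⟨ +-congˡ {δ i j + δ i′ j} (-‿cong (sym (constₚ-+ (M i j) (M i′ j)))) ⟩
      (δ i j + δ i′ j) - c (M i j ℕ.+ M i′ j)      ∎

    charMatrix-rowsˡ : ∀ a b → charMatrix M (a ↑ˡ m) (b ↑ˡ m) + charMatrix M (m ↑ʳ a) (b ↑ˡ m) ≈ charMatrix M′ a b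
    charMatrix-rowsˡ a b = begin
      charMatrix M (a ↑ˡ m) (b ↑ˡ m) + charMatrix M (m ↑ʳ a) (b ↑ˡ m)
        ≈⟨ charMatrix-+ (a ↑ˡ m) (m ↑ʳ a) (b ↑ˡ m) ⟩
      (δ (a ↑ˡ m) (b ↑ˡ m) + δ (m ↑ʳ a) (b ↑ˡ m)) - c (M (a ↑ˡ m) (b ↑ˡ m) ℕ.+ M (m ↑ʳ a) (b ↑ˡ m))
        ≡⟨ ≡.cong₂ (λ p x → p - c x) (≡.cong₂ _+_ (δ-top-top a b) (δ-bottom-top a b)) (M-rows a b) ⟩
      (δ a b + []) - c (M′ a b)
        ≈⟨ +-congʳ (+-identityʳ (δ a b)) ⟩
      charMatrix M′ a b ∎

    charMatrix-rowsʳ : ∀ a b → charMatrix M (a ↑ˡ m) (m ↑ʳ b) + charMatrix M (m ↑ʳ a) (m ↑ʳ b) ≈ charMatrix M′ a b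
    charMatrix-rowsʳ a b = begin
      charMatrix M (a ↑ˡ m) (m ↑ʳ b) + charMatrix M (m ↑ʳ a) (m ↑ʳ b)
        ≈⟨ charMatrix-+ (a ↑ˡ m) (m ↑ʳ a) (m ↑ʳ b) ⟩
      (δ (a ↑ˡ m) (m ↑ʳ b) + δ (m ↑ʳ a) (m ↑ʳ b)) - c (M (a ↑ˡ m) (m ↑ʳ b) ℕ.+ M (m ↑ʳ a) (m ↑ʳ b))
        ≡⟨ ≡.cong₂ (λ p x → p - c x) (≡.cong₂ _+_ (δ-top-bottom a b) (δ-bottom-bottom a b))
                   (≡.trans (≡.cong₂ ℕ._+_ (M-cols (a ↑ˡ m) b) (M-cols (m ↑ʳ a) b)) (M-rows a b)) ⟩
      ([] + δ a b) - c (M′ a b)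
        ≈⟨ +-congʳ (+-identityˡ (δ a b)) ⟩
      charMatrix M′ a b ∎

    charMatrix-cols : ∀ a b → charMatrix M (m ↑ʳ a) (m ↑ʳ b) - charMatrix M (m ↑ʳ a) (b ↑ˡ m) ≈ δ a b
    charMatrix-cols a b = begin
      (δ (m ↑ʳ a) (m ↑ʳ b) - c (M (m ↑ʳ a) (m ↑ʳ b))) - (δ (m ↑ʳ a) (b ↑ˡ m) - c (M (m ↑ʳ a) (b ↑ˡ m)))
        ≡⟨ ≡.cong (λ x → (δ (m ↑ʳ a) (m ↑ʳ b) - c x) - (δ (m ↑ʳ a) (b ↑ˡ m) - c (M (m ↑ʳ a) (b ↑ˡ m))))
                  (M-cols (m ↑ʳ a) b) ⟩
      (δ (m ↑ʳ a) (m ↑ʳ b) - c (M (m ↑ʳ a) (b ↑ˡ m))) - (δ (m ↑ʳ a) (b ↑ˡ m) - c (M (m ↑ʳ a) (b ↑ˡ m)))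
        ≈⟨ [p-r]-[q-r]≈p-q (δ (m ↑ʳ a) (m ↑ʳ b)) (δ (m ↑ʳ a) (b ↑ˡ m)) (c (M (m ↑ʳ a) (b ↑ˡ m))) ⟩
      δ (m ↑ʳ a) (m ↑ʳ b) - δ (m ↑ʳ a) (b ↑ˡ m)
        ≡⟨ ≡.cong₂ _-_ (δ-bottom-bottom a b) (δ-bottom-top a b) ⟩
      δ a b - []
        ≈⟨ trans (+-congˡ -0#≈0#) (+-identityʳ (δ a b)) ⟩
      δ a b ∎

    det-charMatrix-halves : det (m ℕ.+ m) (charMatrix M) ≈ Xpow m * det m (charMatrix M′)
    det-charMatrix-halves = begin
      det (m ℕ.+ m) (charMatrix M)
        ≈⟨ det-halves m (charMatrix M) (charMatrix M′) δ charMatrix-rowsˡ charMatrix-rowsʳ charMatrix-cols ⟩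
      det m (charMatrix M′) * det m δ  ≈⟨ *-congˡ {det m (charMatrix M′)} (det-δ m) ⟩
      det m (charMatrix M′) * Xpow m   ≈⟨ *-comm (det m (charMatrix M′)) (Xpow m) ⟩
      Xpow m * det m (charMatrix M′)   ∎

  P-double : ∀ m → P (m ℕ.+ m) ≈ Xpow m * P m
  P-double zero     = sym (*ₚ-identityˡ (P 0))
  P-double (suc m′) = det-charMatrix-halves (suc m′) (C _) (C _) C-columns C-rows
    where open Collatz.Doubling m′

  P-2^k*N₀ : ∀ k N₀ → P (2 ℕ.^ k ℕ.* N₀) ≈ Xpow (2 ℕ.^ k ℕ.* N₀ ℕ.∸ N₀) * P N₀
  P-2^k*N₀ zero N₀ rewrite ℕ.+-identityʳ N₀ | ℕ.n∸n≡0 N₀ = sym (*ₚ-identityˡ (P N₀))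
  P-2^k*N₀ (suc k) N₀ = ≡.subst (λ n → P n ≈ Xpow (n ℕ.∸ N₀) * P N₀) (≡.sym 2^[1+k]*N₀≡M+M) (begin
    P (M ℕ.+ M)                         ≈⟨ P-double M ⟩
    Xpow M * P M                        ≈⟨ *-congˡ {Xpow M} (P-2^k*N₀ k N₀) ⟩
    Xpow M * (Xpow (M ℕ.∸ N₀) * P N₀)   ≈⟨ sym (*-assoc (Xpow M) (Xpow (M ℕ.∸ N₀)) (P N₀)) ⟩
    (Xpow M * Xpow (M ℕ.∸ N₀)) * P N₀   ≈⟨ *-congʳ {P N₀} (Xpow-+ M (M ℕ.∸ N₀)) ⟩
    Xpow (M ℕ.+ (M ℕ.∸ N₀)) * P N₀      ≡⟨ ≡.cong (λ n → Xpow n * P N₀) (≡.sym (ℕ.+-∸-assoc M N₀≤M)) ⟩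
    Xpow (M ℕ.+ M ℕ.∸ N₀) * P N₀        ∎)
    where
    M = 2 ℕ.^ k ℕ.* N₀
    2^[1+k]*N₀≡M+M : 2 ℕ.^ suc k ℕ.* N₀ ≡ M ℕ.+ M
    2^[1+k]*N₀≡M+M = ≡.trans (ℕ.*-assoc 2 (2 ℕ.^ k) N₀) (≡.cong (λ n → M ℕ.+ n) (ℕ.+-identityʳ M))
    N₀≤M : N₀ ℕ.≤ M
    N₀≤M = ℕ.m≤n*m N₀ (2 ℕ.^ k) {{ℕ.m^n≢0 2 k}}

open import Data.Integer using (+_)
open import Data.Nat using (_≤_; _^_; _*_; _∸_)
open import Data.Nat.Divisibility using (_∣_; divides)
open import Relation.Nullary using (¬_)

det-C-even : (N : ℕ) → 2 ≤ N → 2 ∣ N → detℤ N (λ i j → + (C N i j)) ≡ + 0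
det-C-even N 2≤N (divides zero N≡0) with () ← ℕ.≤-trans 2≤N (ℕ.≤-reflexive N≡0)
det-C-even N 2≤N (divides (suc m′) N≡m*2) =
  ≡.subst (λ n → detℤ n (λ i j → + (C n i j)) ≡ + 0) (≡.sym (≡.trans N≡m*2 (≡.sym N≡m*2′)))
    (det-equalCols (λ i j → + (C N′ i j)) {fzero ↑ˡ suc m′} {suc m′ ↑ʳ fzero} (λ ())
                   (λ i → ≡.cong +_ (≡.sym (C-columns i fzero))))
  where
  open Collatz.Doubling m′ renaming (N to N′; N≡m*2 to N≡m*2′)
  open Determinant ℤ.+-*-commutativeRing using (det-equalCols)

-- Part (b) holds for all k and N₀.
lemma2p9 : ((N : ℕ) → 2 ≤ N → 2 ∣ N → detℤ N (λ i j → + (C N i j)) ≡ + 0)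
    × ((k N₀ : ℕ) → 1 ≤ k → ¬ (2 ∣ N₀) →
    P (2 ^ k * N₀) ≈ₚ (Xpow (2 ^ k * N₀ ∸ N₀) *ₚ P N₀))
lemma2p9 = det-C-even , λ k N₀ _ _ → Polynomial.coeffs (CharacteristicPolynomial.P-2^k*N₀ k N₀)
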